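{- Let $n,k$ be integers with $2\le 2k\le n-4$. Let $\eta=(\eta_1<\dots<\eta_l)\in\overline{\mathbb{D}}^{\,\mathrm{o}}_{2k+2}$, and let $Y_{\eta^*}$ be the Young diagram whose main diagonal consists of exactly the $l+1$ cells $c_{1,1},\dots,c_{l+1,l+1}$ and which satisfies $h_{1,1}=2n-5$, $h_{i,i}=\eta_{l-(i-2)}$ for $2\le i\le l+1$, and $a(c_{i,i})=l(c_{i,i})$ for $1\le i\le l+1$ (so $Y_{\eta^*}$ is self-conjugate). Let $\lambda$ be the partition whose parts are the hook lengths of the cells of the first column of $Y_{\eta^*}$ (equivalently $\lambda=\mathbb{N}_0\setminus S$, where $S$ is the numerical set whose Keith--Nath diagram is $Y_{\eta^*}$). Then $\lambda$ is unrefinable. In particular $\lambda\in\overline{\mathcal{U}}_{T_{n,n-2k}}$.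
   Context: A partition of $N$ into distinct parts is a sequence $\lambda=(\lambda_1<\dots<\lambda_t)$ of positive integers with $t\ge 2$ and $\sum\lambda_i=N$; $\mathbb{D}^{\,\mathrm{o}}_N$ is the set of such partitions all of whose parts are odd. $\overline{\mathbb{D}}^{\,\mathrm{o}}_{2k+2}=\mathbb{D}^{\,\mathrm{o}}_{2k+2}\setminus\{(1,2k+1)\}$ if $2k=n-4$, and $\overline{\mathbb{D}}^{\,\mathrm{o}}_{2k+2}=\mathbb{D}^{\,\mathrm{o}}_{2k+2}$ otherwise. Missing parts: $\mathcal{M}_\lambda=\{1,\dots,\lambda_t\}\setminus\{\lambda_1,\dots,\lambda_t\}$. $\lambda$ is refinable if there are two distinct missing parts whose sum is a part of $\lambda$, unrefinable otherwise. An unrefinable partition of $N$ is maximal if its largest part is maximum among unrefinable partitions of $N$; $\overline{\mathcal{U}}_N$ is the set of maximal unrefinable partitions $\lambda$ of $N$ with $\#\mathcal{M}_\lambda=\lfloor\lambda_t/2\rfloor$. $T_n=n(n+1)/2$ and $T_{n,d}=T_n-d$. Young diagrams in English convention; $c_{i,j}$ is the cell in row $i$, column $j$; arm $a$ = cells to the right, leg $l$ = cells below, hook $h_{i,j}=a(c_{i,j})+l(c_{i,j})+1$. Keith--Nath: for a numerical set $S$ (a subset of $\mathbb{N}_0$ containing $0$ with finite complement), its diagram has one row per gap $g\notin S$, ordered top to bottom by decreasing $g$, the row of $g$ having $\#\{s\in S:s<g\}$ cells; first-column hook lengths are exactly the gaps. -}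

module Defs where

open import Data.Nat using (ℕ; zero; suc; _+_; _*_; _∸_; _≤_; _<_; _≥_; _%_; _/_; _⊔_; _≤?_; _≟_)
open import Data.Nat.ListAction using (sum)
open import Data.List using (List; []; _∷_; length; map; filter; upTo; foldr; reverse)
open import Data.List.Relation.Unary.All using (All)
open import Data.List.Relation.Unary.Linked using (Linked)
open import Data.List.Membership.Propositional using (_∈_; _∉_)
open import Data.List.Membership.DecPropositional _≟_ using (_∈?_)
open import Data.Product using (Σ; _×_)
open import Relation.Binary.PropositionalEquality using (_≡_; _≢_)
open import Relation.Nullary using (¬_)
open import Relation.Nullary.Decidable using (¬?)

Odd : ℕ → Set
Odd m = m % 2 ≡ 1

IsDistinctPartition : ℕ → List ℕ → Set
IsDistinctPartition N lam =
  Linked _<_ lam × All (1 ≤_) lam × (2 ≤ length lam) × (sum lam ≡ N)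

InDo : ℕ → List ℕ → Set
InDo N lam = IsDistinctPartition N lam × All Odd lam

InDoBar : (n k : ℕ) → List ℕ → Set
InDoBar n k eta =
  InDo (2 * k + 2) eta × (2 * k + 4 ≡ n → eta ≢ (1 ∷ (2 * k + 1) ∷ []))

-- largest part λ_t (the parts are listed increasingly; max is used)
largest : List ℕ → ℕ
largest = foldr _⊔_ 0

IsMissing : List ℕ → ℕ → Set
IsMissing lam a = (1 ≤ a) × (a ≤ largest lam) × (a ∉ lam)

missing : List ℕ → List ℕ
missing lam = filter (λ a → ¬? (a ∈? lam)) (map suc (upTo (largest lam)))

Refinable : List ℕ → Set
Refinable lam = Σ ℕ λ a → Σ ℕ λ b →
  (a ≢ b) × IsMissing lam a × IsMissing lam b × ((a + b) ∈ lam)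

Unrefinable : List ℕ → Set
Unrefinable lam = ¬ Refinable lam

IsMaximalUnrefinable : ℕ → List ℕ → Set
IsMaximalUnrefinable N lam =
  IsDistinctPartition N lam × Unrefinable lam ×
  ((mu : List ℕ) → IsDistinctPartition N mu → Unrefinable mu →
     largest mu ≤ largest lam)

InUbar : ℕ → List ℕ → Set
InUbar N lam = IsMaximalUnrefinable N lam × (length (missing lam) ≡ largest lam / 2)

T : ℕ → ℕ
T n = n * (n + 1) / 2

-- Young diagrams (English convention), given by the list of row
-- lengths from top to bottom; rows and columns are 1-indexed.

-- 1-indexed lookup with default 0
nth : List ℕ → ℕ → ℕ
nth _ zero = 0
nth [] (suc _) = 0
nth (x ∷ xs) (suc zero) = x
nth (x ∷ xs) (suc (suc i)) = nth xs (suc i)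

IsYoungDiagram : List ℕ → Set
IsYoungDiagram rs = All (1 ≤_) rs × Linked _≥_ rs

rowLen : List ℕ → ℕ → ℕ
rowLen = nth

colLen : List ℕ → ℕ → ℕ
colLen rs j = length (filter (j ≤?_) rs)

InY : List ℕ → ℕ → ℕ → Set
InY rs i j = (1 ≤ i) × (1 ≤ j) × (j ≤ rowLen rs i)

arm : List ℕ → ℕ → ℕ → ℕ
arm rs i j = rowLen rs i ∸ j

leg : List ℕ → ℕ → ℕ → ℕ
leg rs i j = colLen rs j ∸ i

hook : List ℕ → ℕ → ℕ → ℕ
hook rs i j = arm rs i j + leg rs i j + 1

firstColumnHooks : List ℕ → List ℕ
firstColumnHooks rs = map (λ i → hook rs (suc i) 1) (upTo (length rs))

hookPartition : List ℕ → List ℕ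
hookPartition rs = reverse (firstColumnHooks rs)

-- Write a₁ > a₂ > ⋯ > a_r for the arms of the diagonal cells of Y.  Since arm = leg on the diagonal,
-- Y has a₁ + 1 rows; the rows through the Durfee square have first-column hooks a₁ + 1 + aⱼ, and the
-- rows below it have as hooks exactly the numbers in [1, a₁] other than the a₁ ∸ aⱼ (Keith–Nath).
-- Here a₁ = n − 3 and the other arms are the (ηᵢ − 1)/2, which are small since η ⊢ 2k + 2 ≤ n − 2.
-- So a missing part is either some a₁ ∸ aⱼ or lies above a₁, and if two of them summed to a part,
-- either that sum would exceed 2n − 5 or two or three distinct parts of η would add up to more than
-- 2k + 2, unless η = (1, 2k + 1) and 2k = n − 4.  Pairing x with 2a₁ + 1 ∸ x, exactly one of which is
-- a part, gives the sum of λ; the same pairing shows that an unrefinable partition of that number with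
-- a larger largest part would have too large a sum or the wrong parity, so λ is maximal.

module Submission where

open import Defs
open import Data.Bool using (if_then_else_)
open import Data.Empty using (⊥; ⊥-elim)
open import Data.List using (List; []; _∷_; length; map; filter; applyUpTo; applyDownFrom; reverse)
open import Data.List.Membership.Propositional using (_∈_; _∉_; find; lose)
open import Data.List.Membership.Propositional.Properties using (∈-applyDownFrom⁺; ∈-applyDownFrom⁻)
open import Data.List.Properties using (map-id; map-id-local; map-applyUpTo; reverse-applyUpTo; length-applyDownFrom; length-filter; filter-accept; filter-all; filter-none)
open import Data.List.Relation.Unary.All as All using (All; []; _∷_; tabulate)
open import Data.List.Relation.Unary.Any using (Any; here; there; any?; toSum)
open import Data.List.Relation.Unary.All.Properties using (All¬⇒¬Any)
open import Data.List.Relation.Unary.Any.Properties using (¬Any[])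
open import Data.List.Relation.Unary.AllPairs as AllPairs using (AllPairs; []; _∷_)
open import Data.List.Relation.Unary.Linked as Linked using (Linked; []; [-]; _∷_)
open import Data.List.Relation.Unary.Linked.Properties using (Linked⇒All; Linked⇒AllPairs; applyDownFrom⁺₁)
open import Data.Nat
open import Data.Nat.Properties
open import Data.List.Membership.DecPropositional _≟_ using (_∈?_)
open import Data.Nat.DivMod using (m/n≡1+[m∸n]/n; m*n/n≡m)
open import Data.Nat.ListAction using (sum)
open import Data.Nat.Tactic.RingSolver using (solve-∀)
open import Data.Product using (∃; ∃₂; _×_; _,_; proj₁; proj₂)
open import Data.Sum using (_⊎_; inj₁; inj₂; [_,_]; map₂)
open import Function.Base using (_∘_; id; const)
open import Function.Bundles using (_⇔_; mk⇔; module Equivalence)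
open import Relation.Nullary using (¬_; Dec; yes; no; does; ¬?; _×-dec_)
open import Relation.Nullary.Decidable using (decidable-stable)
open import Relation.Binary.PropositionalEquality hiding ([_])

open Equivalence using (to; from)

+-double-cancel-≤ : ∀ {a b} → a + a ≤ b + b → a ≤ b
+-double-cancel-≤ {a} {b} a+a≤b+b with a ≤? b
... | yes a≤b = a≤b
... | no a≰b = ⊥-elim (<-irrefl refl (<-≤-trans (+-mono-< (≰⇒> a≰b) (≰⇒> a≰b)) a+a≤b+b))

+-double-injective : ∀ {a b} → a + a ≡ b + b → a ≡ b
+-double-injective a+a≡b+b = ≤-antisym (+-double-cancel-≤ (≤-reflexive a+a≡b+b)) (+-double-cancel-≤ (≤-reflexive (sym a+a≡b+b)))

halves : ∀ n → ∃₂ λ h e → e ≤ 1 × n ≡ h + h + e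
halves zero = 0 , 0 , z≤n , refl
halves (suc n) with halves n
... | h , 0 , _ , n≡ = h , 1 , s≤s z≤n , trans (cong suc n≡) (even+1 h)
  where
  even+1 : ∀ h → suc (h + h + 0) ≡ h + h + 1
  even+1 = solve-∀
... | h , 1 , _ , n≡ = suc h , 0 , z≤n , trans (cong suc n≡) (odd+1 h)
  where
  odd+1 : ∀ h → suc (h + h + 1) ≡ suc h + suc h + 0
  odd+1 = solve-∀
... | _ , 2+ _ , s≤s () , _

half-odd : ∀ x → suc (x + x) / 2 ≡ x
half-odd zero = refl
half-odd (suc x) = begin
  suc (suc x + suc x) / 2       ≡⟨ cong (λ z → suc (suc z) / 2) (+-suc x x) ⟩
  suc (suc (suc (x + x))) / 2   ≡⟨ m/n≡1+[m∸n]/n {suc (suc (suc (x + x)))} {2} (s≤s (s≤s z≤n)) ⟩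
  suc (suc (x + x) / 2)         ≡⟨ cong suc (half-odd x) ⟩
  suc x                         ∎
  where open ≡-Reasoning

boundary : {Q : ℕ → Set} → (∀ i → Dec (Q i)) → ∀ lo d → Q lo → ¬ Q (lo + d) →
           ∃ λ i → lo ≤ i × i < lo + d × Q i × ¬ Q (suc i)
boundary {Q} Q? lo zero Qlo ¬Qend = ⊥-elim (¬Qend (subst Q (sym (+-identityʳ lo)) Qlo))
boundary {Q} Q? lo (suc d) Qlo ¬Qend with Q? (suc lo)
... | no ¬Qnext = lo , ≤-refl , m<m+n lo z<s , Qlo , ¬Qnext
... | yes Qnext with boundary Q? (suc lo) d Qnext (¬Qend ∘ subst Q (sym (+-suc lo d)))
...   | i , lo<i , i<end , Qi , ¬Qi+1 = i , <⇒≤ lo<i , ≤-trans i<end (≤-reflexive (sym (+-suc lo d))) , Qi , ¬Qi+1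

-- Sums over ranges

[_]·_ : {P : Set} → Dec P → ℕ → ℕ
[ d ]· v = if does d then v else 0

[]·-yes : {P : Set} (d : Dec P) {v : ℕ} → P → [ d ]· v ≡ v
[]·-yes (yes _) _ = refl
[]·-yes (no ¬p) p = ⊥-elim (¬p p)

[]·-no : {P : Set} (d : Dec P) {v : ℕ} → ¬ P → [ d ]· v ≡ 0
[]·-no (yes p) ¬p = ⊥-elim (¬p p)
[]·-no (no _) _ = refl

[]·-congʳ : {P : Set} (d : Dec P) {v w : ℕ} → (P → v ≡ w) → [ d ]· v ≡ [ d ]· w
[]·-congʳ (yes p) v≡w = v≡w p
[]·-congʳ (no _) _ = refl

[]·-complement : {P : Set} (d : Dec P) {v : ℕ} → [ ¬? d ]· v + [ d ]· v ≡ v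
[]·-complement (yes _) = refl
[]·-complement (no _) = +-identityʳ _

[]·-split : {P Q R : Set} (p? : Dec P) (q? : Dec Q) (r? : Dec R) {v : ℕ} →
            (P → Q ⊎ R) → (Q → P) → (R → P) → ¬ (Q × R) →
            [ p? ]· v ≡ [ q? ]· v + [ r? ]· v
[]·-split (yes _) (yes q) (yes r) _ _ _ disj = ⊥-elim (disj (q , r))
[]·-split (yes _) (yes _) (no _) _ _ _ _ = sym (+-identityʳ _)
[]·-split (yes _) (no _) (yes _) _ _ _ _ = refl
[]·-split (yes p) (no ¬q) (no ¬r) split _ _ _ with split p
... | inj₁ q = ⊥-elim (¬q q)
... | inj₂ r = ⊥-elim (¬r r)
[]·-split (no ¬p) (yes q) _ _ q⇒p _ _ = ⊥-elim (¬p (q⇒p q))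
[]·-split (no ¬p) (no _) (yes r) _ _ r⇒p _ = ⊥-elim (¬p (r⇒p r))
[]·-split (no _) (no _) (no _) _ _ _ _ = refl

-- ∑ f lo c = f lo + f (lo + 1) + ⋯ + f (lo + c ∸ 1): the last argument counts the terms.
∑ : (ℕ → ℕ) → ℕ → ℕ → ℕ
∑ f lo zero = 0
∑ f lo (suc c) = f lo + ∑ f (suc lo) c

module _ {f g : ℕ → ℕ} where

  ∑-cong : ∀ lo c → (∀ x → lo ≤ x → x < lo + c → f x ≡ g x) → ∑ f lo c ≡ ∑ g lo c
  ∑-cong lo zero _ = refl
  ∑-cong lo (suc c) f≡g = cong₂ _+_ (f≡g lo ≤-refl (m<m+n lo z<s))
    (∑-cong (suc lo) c (λ x lo<x x<end → f≡g x (<⇒≤ lo<x) (≤-trans x<end (≤-reflexive (sym (+-suc lo c))))))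

  ∑-mono-≤ : ∀ lo c → (∀ x → lo ≤ x → x < lo + c → f x ≤ g x) → ∑ f lo c ≤ ∑ g lo c
  ∑-mono-≤ lo zero _ = ≤-refl
  ∑-mono-≤ lo (suc c) f≤g = +-mono-≤ (f≤g lo ≤-refl (m<m+n lo z<s))
    (∑-mono-≤ (suc lo) c (λ x lo<x x<end → f≤g x (<⇒≤ lo<x) (≤-trans x<end (≤-reflexive (sym (+-suc lo c))))))

∑-distrib-+ : ∀ (f g : ℕ → ℕ) lo c → ∑ (λ x → f x + g x) lo c ≡ ∑ f lo c + ∑ g lo c
∑-distrib-+ f g lo zero = refl
∑-distrib-+ f g lo (suc c) =
  trans (cong (f lo + g lo +_) (∑-distrib-+ f g (suc lo) c)) (+-comm-middle (f lo) (g lo) _ _)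
  where
  +-comm-middle : ∀ a b c d → a + b + (c + d) ≡ a + c + (b + d)
  +-comm-middle = solve-∀

∑-const : ∀ v lo c → ∑ (const v) lo c ≡ c * v
∑-const v lo zero = refl
∑-const v lo (suc c) = cong (v +_) (∑-const v (suc lo) c)

∑-last : ∀ (f : ℕ → ℕ) lo c → ∑ f lo (suc c) ≡ ∑ f lo c + f (lo + c)
∑-last f lo zero = trans (+-identityʳ (f lo)) (cong f (sym (+-identityʳ lo)))
∑-last f lo (suc c) = begin
  f lo + ∑ f (suc lo) (suc c)           ≡⟨ cong (f lo +_) (∑-last f (suc lo) c) ⟩
  f lo + (∑ f (suc lo) c + f (suc lo + c)) ≡⟨ sym (+-assoc (f lo) _ _) ⟩
  f lo + ∑ f (suc lo) c + f (suc lo + c)   ≡⟨ cong (λ z → f lo + ∑ f (suc lo) c + f z) (sym (+-suc lo c)) ⟩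
  f lo + ∑ f (suc lo) c + f (lo + suc c)   ∎
  where open ≡-Reasoning

∑-delta-below : ∀ v w lo c → v < lo → ∑ (λ x → [ x ≟ v ]· w) lo c ≡ 0
∑-delta-below v w lo zero _ = refl
∑-delta-below v w lo (suc c) v<lo =
  cong₂ _+_ ([]·-no (lo ≟ v) (λ lo≡v → <-irrefl (sym lo≡v) v<lo)) (∑-delta-below v w (suc lo) c (m<n⇒m<1+n v<lo))

∑-delta : ∀ v w lo c → lo ≤ v → v < lo + c → ∑ (λ x → [ x ≟ v ]· w) lo c ≡ w
∑-delta v w lo zero lo≤v v<lo+0 = ⊥-elim (<-irrefl refl (≤-trans v<lo+0 (≤-trans (≤-reflexive (+-identityʳ lo)) lo≤v)))
∑-delta v w lo (suc c) lo≤v v<end with lo ≟ v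
... | yes lo≡v = trans (cong₂ _+_ ([]·-yes (lo ≟ v) lo≡v) (∑-delta-below v w (suc lo) c (s≤s (≤-reflexive (sym lo≡v)))))
                       (+-identityʳ w)
... | no lo≢v = trans (cong (_+ ∑ (λ x → [ x ≟ v ]· w) (suc lo) c) ([]·-no (lo ≟ v) lo≢v))
                      (∑-delta v w (suc lo) c (≤∧≢⇒< lo≤v lo≢v) (≤-trans v<end (≤-reflexive (+-suc lo c))))

-- The terms a and K ∸ a are paired off; when the count is odd the middle term is left over.
∑-pair : ∀ (f : ℕ → ℕ) e q lo K → e ≤ 1 → lo + lo + q + q + e ≡ suc K →
         ∑ f lo (q + q + e) ≡ ∑ (λ a → f a + f (K ∸ a)) lo q + e * f (lo + q)
∑-pair f .0 zero lo K z≤n _ = refl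
∑-pair f .1 zero lo K (s≤s z≤n) _ = cong (λ z → f z + 0) (sym (+-identityʳ lo))
∑-pair f e (suc q) lo K e≤1 lo+lo+q+q+e≡1+K = begin
  ∑ f lo (suc q + suc q + e)
    ≡⟨ cong (λ z → ∑ f lo (z + e)) (+-suc (suc q) q) ⟩
  f lo + ∑ f (suc lo) (suc (q + q + e))
    ≡⟨ cong (f lo +_) (∑-last f (suc lo) (q + q + e)) ⟩
  f lo + (∑ f (suc lo) (q + q + e) + f (suc lo + (q + q + e)))
    ≡⟨ cong₂ (λ s t → f lo + (s + f t)) (∑-pair f e q (suc lo) K e≤1 inner) partner ⟩
  f lo + (∑ pairs (suc lo) q + e * f (suc lo + q) + f (K ∸ lo))
    ≡⟨ shuffle (f lo) (∑ pairs (suc lo) q) (e * f (suc lo + q)) (f (K ∸ lo)) ⟩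
  f lo + f (K ∸ lo) + ∑ pairs (suc lo) q + e * f (suc lo + q)
    ≡⟨ cong (λ z → f lo + f (K ∸ lo) + ∑ pairs (suc lo) q + e * f z) (sym (+-suc lo q)) ⟩
  f lo + f (K ∸ lo) + ∑ pairs (suc lo) q + e * f (lo + suc q) ∎
  where
  open ≡-Reasoning
  pairs : ℕ → ℕ
  pairs a = f a + f (K ∸ a)
  shuffle : ∀ a b c d → a + (b + c + d) ≡ a + d + b + c
  shuffle = solve-∀
  inner : suc lo + suc lo + q + q + e ≡ suc K
  inner = trans (shift lo q e) lo+lo+q+q+e≡1+K
    where
    shift : ∀ lo q e → suc lo + suc lo + q + q + e ≡ lo + lo + suc q + suc q + e
    shift = solve-∀
  partner : suc lo + (q + q + e) ≡ K ∸ lo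
  partner = sym (trans (cong (_∸ lo) (suc-injective (trans (sym lo+lo+q+q+e≡1+K) (shift lo q e))))
                       (m+n∸m≡n lo _))
    where
    shift : ∀ lo q e → lo + lo + suc q + suc q + e ≡ suc (lo + (suc lo + (q + q + e)))
    shift = solve-∀

tri : ℕ → ℕ
tri = ∑ id 1

tri-suc : ∀ c → tri (suc c) ≡ suc c + tri c
tri-suc c = trans (∑-last id 1 c) (+-comm (tri c) (suc c))

tri-mono-≤ : ∀ {m n} → m ≤ n → tri m ≤ tri n
tri-mono-≤ m≤n = mono (≤⇒≤′ m≤n)
  where
  mono : ∀ {m n} → m ≤′ n → tri m ≤ tri n
  mono ≤′-refl = ≤-refl
  mono (≤′-step {n} m≤′n) = ≤-trans (mono m≤′n) (≤-trans (m≤n+m (tri n) (suc n)) (≤-reflexive (sym (tri-suc n))))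

T≡tri : ∀ n → T n ≡ tri n
T≡tri n = trans (cong (_/ 2) (trans (sym (twice-tri n)) (*-comm 2 (tri n)))) (m*n/n≡m (tri n) 2)
  where
  twice-tri : ∀ n → 2 * tri n ≡ n * (n + 1)
  twice-tri zero = refl
  twice-tri (suc n) = begin
    2 * tri (suc n)            ≡⟨ cong (2 *_) (tri-suc n) ⟩
    2 * (suc n + tri n)        ≡⟨ *-distribˡ-+ 2 (suc n) (tri n) ⟩
    2 * suc n + 2 * tri n      ≡⟨ cong (2 * suc n +_) (twice-tri n) ⟩
    2 * suc n + n * (n + 1)    ≡⟨ step n ⟩
    suc n * (suc n + 1)        ∎
    where
    open ≡-Reasoning
    step : ∀ n → 2 * suc n + n * (n + 1) ≡ suc n * (suc n + 1)
    step = solve-∀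

≥-head : ∀ {y ys} → Linked _≥_ (y ∷ ys) → All (_≤ y) ys
≥-head [-] = []
≥-head (y≥x ∷ lin) = Linked⇒All (λ a≥b b≥c → ≤-trans b≥c a≥b) y≥x lin

<-head : ∀ {y ys} → Linked _<_ (y ∷ ys) → All (y <_) ys
<-head [-] = []
<-head (y<x ∷ lin) = Linked⇒All <-trans y<x lin

∈⇒≤largest : ∀ {x} xs → x ∈ xs → x ≤ largest xs
∈⇒≤largest (y ∷ ys) (here refl) = m≤m⊔n y (largest ys)
∈⇒≤largest (y ∷ ys) (there x∈ys) = ≤-trans (∈⇒≤largest ys x∈ys) (m≤n⊔m y (largest ys))

largest-∈ : ∀ xs → 1 ≤ length xs → largest xs ∈ xs
largest-∈ (x ∷ xs) _ = ∈cons x xs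
  where
  ∈cons : ∀ x xs → largest (x ∷ xs) ∈ x ∷ xs
  ∈cons x [] = here (⊔-identityʳ x)
  ∈cons x (y ∷ ys) with ⊔-sel x (largest (y ∷ ys))
  ... | inj₁ ≡x = here ≡x
  ... | inj₂ ≡rest = there (subst (_∈ y ∷ ys) (sym ≡rest) (∈cons y ys))

largest-≤ : ∀ {M} xs → All (_≤ M) xs → largest xs ≤ M
largest-≤ [] [] = z≤n
largest-≤ (_ ∷ xs) (x≤M ∷ xs≤M) = ⊔-lub x≤M (largest-≤ xs xs≤M)

nth-∈ : ∀ xs i → 1 ≤ i → i ≤ length xs → nth xs i ∈ xs
nth-∈ (x ∷ xs) 1 _ _ = here refl
nth-∈ (x ∷ xs) (2+ i) _ (s≤s i<len) = there (nth-∈ xs (suc i) (s≤s z≤n) i<len)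

∈⇒nth : ∀ {x} xs → x ∈ xs → ∃₂ λ i (_ : 1 ≤ i × i ≤ length xs) → nth xs i ≡ x
∈⇒nth (y ∷ xs) (here refl) = 1 , (s≤s z≤n , s≤s z≤n) , refl
∈⇒nth (y ∷ xs) (there x∈xs) with ∈⇒nth xs x∈xs
... | suc i , (_ , i≤len) , nth≡x = 2+ i , (s≤s z≤n , s≤s i≤len) , nth≡x

nth-beyond : ∀ xs i → length xs < i → nth xs i ≡ 0
nth-beyond [] zero _ = refl
nth-beyond [] (suc i) _ = refl
nth-beyond (x ∷ xs) (2+ i) (s≤s len<i) = nth-beyond xs (suc i) len<i

nth-All : ∀ {P : ℕ → Set} xs i → All P xs → P 0 → P (nth xs i)
nth-All xs zero _ p0 = p0
nth-All [] (suc i) _ p0 = p0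
nth-All (x ∷ xs) 1 (px ∷ _) _ = px
nth-All (x ∷ xs) (2+ i) (_ ∷ pxs) p0 = nth-All xs (suc i) pxs p0

nth-positive : ∀ xs → All (1 ≤_) xs → ∀ i → 1 ≤ i → i ≤ length xs → 1 ≤ nth xs i
nth-positive xs pos i 1≤i i≤len = All.lookup pos (nth-∈ xs i 1≤i i≤len)

nth-antitone : ∀ xs → Linked _≥_ xs → ∀ {i j} → 1 ≤ i → i ≤ j → nth xs j ≤ nth xs i
nth-antitone [] _ {j = zero} _ _ = z≤n
nth-antitone [] _ {j = suc _} _ _ = z≤n
nth-antitone (x ∷ xs) _ {1} {1} _ _ = ≤-refl
nth-antitone (x ∷ xs) lin {1} {2+ j} _ _ = nth-All xs (suc j) (≥-head lin) z≤n
nth-antitone (x ∷ xs) _ {2+ i} {1} _ (s≤s ())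
nth-antitone (x ∷ []) _ {2+ i} {2+ j} _ _ = z≤n
nth-antitone (x ∷ y ∷ xs) (_ ∷ lin) {2+ i} {2+ j} _ (s≤s i≤j) = nth-antitone (y ∷ xs) lin (s≤s z≤n) i≤j

∈⇒≤sum : ∀ {x} xs → x ∈ xs → x ≤ sum xs
∈⇒≤sum (y ∷ ys) (here refl) = m≤m+n y (sum ys)
∈⇒≤sum (y ∷ ys) (there x∈ys) = ≤-trans (∈⇒≤sum ys x∈ys) (m≤n+m (sum ys) y)

two-∈⇒≤sum : ∀ {x y} xs → x ∈ xs → y ∈ xs → x ≢ y → x + y ≤ sum xs
two-∈⇒≤sum (w ∷ ws) (here refl) (here refl) x≢y = ⊥-elim (x≢y refl)
two-∈⇒≤sum (w ∷ ws) (here refl) (there y∈ws) _ = +-monoʳ-≤ w (∈⇒≤sum ws y∈ws)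
two-∈⇒≤sum {x} (w ∷ ws) (there x∈ws) (here refl) _ = ≤-trans (≤-reflexive (+-comm x w)) (+-monoʳ-≤ w (∈⇒≤sum ws x∈ws))
two-∈⇒≤sum (w ∷ ws) (there x∈ws) (there y∈ws) x≢y = ≤-trans (two-∈⇒≤sum ws x∈ws y∈ws x≢y) (m≤n+m (sum ws) w)

three-∈⇒≤sum : ∀ {x y z} xs → x ∈ xs → y ∈ xs → z ∈ xs → x ≢ y → x ≢ z → y ≢ z → x + y + z ≤ sum xs
three-∈⇒≤sum (w ∷ ws) (here refl) (here refl) _ x≢y _ _ = ⊥-elim (x≢y refl)
three-∈⇒≤sum (w ∷ ws) (here refl) _ (here refl) _ x≢z _ = ⊥-elim (x≢z refl)
three-∈⇒≤sum (w ∷ ws) _ (here refl) (here refl) _ _ y≢z = ⊥-elim (y≢z refl)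
three-∈⇒≤sum {x} {y} {z} (w ∷ ws) (here refl) (there y∈ws) (there z∈ws) _ _ y≢z =
  ≤-trans (≤-reflexive (+-assoc x y z)) (+-monoʳ-≤ w (two-∈⇒≤sum ws y∈ws z∈ws y≢z))
three-∈⇒≤sum {x} {y} {z} (w ∷ ws) (there x∈ws) (here refl) (there z∈ws) _ x≢z _ =
  ≤-trans (≤-reflexive (trans (cong (_+ z) (+-comm x y)) (+-assoc y x z))) (+-monoʳ-≤ w (two-∈⇒≤sum ws x∈ws z∈ws x≢z))
three-∈⇒≤sum {x} {y} {z} (w ∷ ws) (there x∈ws) (there y∈ws) (here refl) x≢y _ _ =
  ≤-trans (≤-reflexive (+-comm (x + y) z)) (+-monoʳ-≤ w (two-∈⇒≤sum ws x∈ws y∈ws x≢y))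
three-∈⇒≤sum (w ∷ ws) (there x∈ws) (there y∈ws) (there z∈ws) x≢y x≢z y≢z =
  ≤-trans (three-∈⇒≤sum ws x∈ws y∈ws z∈ws x≢y x≢z y≢z) (m≤n+m (sum ws) w)

sum≡1+m⇒≡[1,m] : ∀ {m} xs → Linked _<_ xs → All (1 ≤_) xs → 1 ∈ xs → m ∈ xs → m ≢ 1 → sum xs ≡ 1 + m →
                 xs ≡ 1 ∷ m ∷ []
sum≡1+m⇒≡[1,m] {m} (x ∷ ys) lin (1≤x ∷ pos) 1∈xs m∈xs m≢1 sum≡ = cong₂ _∷_ x≡1 (ys≡[m] ys pos m∈ys sum-ys)
  where
  head≡1 : 1 ∈ x ∷ ys → x ≡ 1
  head≡1 (here 1≡x) = sym 1≡x
  head≡1 (there 1∈ys) = ⊥-elim (<-irrefl refl (≤-trans 1≤x (s≤s⁻¹ (All.lookup (<-head lin) 1∈ys))))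
  x≡1 : x ≡ 1
  x≡1 = head≡1 1∈xs
  ∈tail : m ∈ x ∷ ys → m ∈ ys
  ∈tail (here m≡x) = ⊥-elim (m≢1 (trans m≡x x≡1))
  ∈tail (there m∈ys) = m∈ys
  m∈ys : m ∈ ys
  m∈ys = ∈tail m∈xs
  sum-ys : sum ys ≡ m
  sum-ys = suc-injective (trans (cong (_+ sum ys) (sym x≡1)) sum≡)
  ys≡[m] : ∀ zs → All (1 ≤_) zs → m ∈ zs → sum zs ≡ m → zs ≡ m ∷ []
  ys≡[m] (z ∷ []) _ (here refl) _ = refl
  ys≡[m] (z ∷ w ∷ zs) (_ ∷ 1≤w ∷ _) (here refl) sum≡z =
    ⊥-elim (<⇒≢ (≤-trans 1≤w (m≤m+n w (sum zs))) (sym (+-cancelˡ-≡ z (w + sum zs) 0 (trans sum≡z (sym (+-identityʳ z))))))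
  ys≡[m] (z ∷ zs) (1≤z ∷ _) (there m∈zs) sum≡m =
    ⊥-elim (<-irrefl refl (≤-trans (+-mono-≤ 1≤z (∈⇒≤sum zs m∈zs)) (≤-reflexive sum≡m)))

-- Sums over lists of distinct numbers

Linked<⇒distinct : {xs : List ℕ} → Linked _<_ xs → AllPairs _≢_ xs
Linked<⇒distinct = AllPairs.map <⇒≢ ∘ Linked⇒AllPairs <-trans

injective-on⇒distinct-image : ∀ (g : ℕ → ℕ) {xs} → (∀ {s t} → s ∈ xs → t ∈ xs → g s ≡ g t → s ≡ t) →
                              AllPairs _≢_ xs → AllPairs (λ s t → g s ≢ g t) xs
injective-on⇒distinct-image g inj [] = []
injective-on⇒distinct-image g inj (s≢xs ∷ distinct) =
  tabulate (λ t∈ gs≡gt → All.lookup s≢xs t∈ (inj (here refl) (there t∈) gs≡gt))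
  ∷ injective-on⇒distinct-image g (λ s∈ t∈ → inj (there s∈) (there t∈)) distinct

module _ (f g : ℕ → ℕ) where

  ∑-[]·-image : {P : ℕ → Set} (P? : ∀ x → Dec (P x)) (S : List ℕ) (lo c : ℕ) →
                (∀ x → lo ≤ x → x < lo + c → P x ⇔ Any (λ s → x ≡ g s) S) →
                AllPairs (λ s t → g s ≢ g t) S → All (λ s → lo ≤ g s × g s < lo + c) S →
                ∑ (λ x → [ P? x ]· f x) lo c ≡ sum (map (f ∘ g) S)
  ∑-[]·-image P? [] lo c P⇔ [] [] =
    trans (∑-cong lo c (λ x l u → []·-no (P? x) (¬Any[] ∘ to (P⇔ x l u)))) (trans (∑-const 0 lo c) (*-zeroʳ c))
  ∑-[]·-image P? (s ∷ S) lo c P⇔ (gs∉gS ∷ distinct) ((lo≤gs , gs<end) ∷ inRange) = begin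
    ∑ (λ x → [ P? x ]· f x) lo c
      ≡⟨ ∑-cong lo c split ⟩
    ∑ (λ x → [ x ≟ g s ]· f (g s) + [ Q? x ]· f x) lo c
      ≡⟨ ∑-distrib-+ (λ x → [ x ≟ g s ]· f (g s)) (λ x → [ Q? x ]· f x) lo c ⟩
    ∑ (λ x → [ x ≟ g s ]· f (g s)) lo c + ∑ (λ x → [ Q? x ]· f x) lo c
      ≡⟨ cong₂ _+_ (∑-delta (g s) (f (g s)) lo c lo≤gs gs<end)
                   (∑-[]·-image Q? S lo c (λ _ _ _ → mk⇔ id id) distinct inRange) ⟩
    f (g s) + sum (map (f ∘ g) S) ∎
    where
    open ≡-Reasoning
    Q? : ∀ x → Dec (Any (λ t → x ≡ g t) S)
    Q? x = any? (λ t → x ≟ g t) S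
    notBoth : ∀ {x} → ¬ (x ≡ g s × Any (λ t → x ≡ g t) S)
    notBoth (refl , x∈gS) = All¬⇒¬Any gs∉gS x∈gS
    split : ∀ x → lo ≤ x → x < lo + c → [ P? x ]· f x ≡ [ x ≟ g s ]· f (g s) + [ Q? x ]· f x
    split x l u = trans ([]·-split (P? x) (x ≟ g s) (Q? x) (toSum ∘ to (P⇔ x l u))
                                   (from (P⇔ x l u) ∘ here) (from (P⇔ x l u) ∘ there) notBoth)
                        (cong (_+ [ Q? x ]· f x) ([]·-congʳ (x ≟ g s) (cong f)))

weight : List ℕ → ℕ → ℕ
weight xs a = [ a ∈? xs ]· a

weight-∈ : ∀ {a xs} → a ∈ xs → weight xs a ≡ a
weight-∈ {a} {xs} = []·-yes (a ∈? xs)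

weight-∉ : ∀ {a xs} → a ∉ xs → weight xs a ≡ 0
weight-∉ {a} {xs} = []·-no (a ∈? xs)

sum≡∑-weight : (xs : List ℕ) (M : ℕ) → AllPairs _≢_ xs → All (λ x → 1 ≤ x × x < 1 + M) xs →
               sum xs ≡ ∑ (weight xs) 1 M
sum≡∑-weight xs M distinct range =
  sym (trans (∑-[]·-image id id (_∈? xs) xs 1 M (λ _ _ _ → mk⇔ id id) distinct range) (cong sum (map-id xs)))

length≡∑-indicator : (xs : List ℕ) (M : ℕ) → AllPairs _≢_ xs → All (λ x → 1 ≤ x × x < 1 + M) xs →
                length xs ≡ ∑ (λ x → [ x ∈? xs ]· 1) 1 M
length≡∑-indicator xs M distinct range =
  sym (trans (∑-[]·-image (const 1) id (_∈? xs) xs 1 M (λ _ _ _ → mk⇔ id id) distinct range) (sum-map-const xs))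
  where
  sum-map-const : (ys : List ℕ) → sum (map (const 1) ys) ≡ length ys
  sum-map-const [] = refl
  sum-map-const (_ ∷ ys) = cong suc (sum-map-const ys)

length-filter-∷ : {P : ℕ → Set} (P? : ∀ x → Dec (P x)) (x : ℕ) (xs : List ℕ) →
                  length (filter P? (x ∷ xs)) ≡ [ P? x ]· 1 + length (filter P? xs)
length-filter-∷ P? x xs with P? x
... | yes _ = refl
... | no _ = refl

length-filter-applyUpTo : {P : ℕ → Set} (P? : ∀ x → Dec (P x)) (f : ℕ → ℕ) (c lo : ℕ) → (∀ i → f i ≡ lo + i) →
                          length (filter P? (applyUpTo f c)) ≡ ∑ (λ x → [ P? x ]· 1) lo c
length-filter-applyUpTo P? f zero lo f≡ = refl
length-filter-applyUpTo P? f (suc c) lo f≡ =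
  trans (length-filter-∷ P? (f 0) (applyUpTo (f ∘ suc) c))
        (cong₂ _+_ (cong (λ y → [ P? y ]· 1) (trans (f≡ 0) (+-identityʳ lo)))
                   (length-filter-applyUpTo P? (f ∘ suc) c (suc lo) (λ i → trans (f≡ (suc i)) (+-suc lo i))))

length-missing : (xs : List ℕ) → Linked _<_ xs → All (1 ≤_) xs → length (missing xs) + length xs ≡ largest xs
length-missing xs lin pos = begin
  length (missing xs) + length xs
    ≡⟨ cong₂ _+_ missing≡ (length≡∑-indicator xs M (Linked<⇒distinct lin) range) ⟩
  ∑ (λ x → [ ¬? (x ∈? xs) ]· 1) 1 M + ∑ (λ x → [ x ∈? xs ]· 1) 1 M
    ≡⟨ sym (∑-distrib-+ (λ x → [ ¬? (x ∈? xs) ]· 1) (λ x → [ x ∈? xs ]· 1) 1 M) ⟩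
  ∑ (λ x → [ ¬? (x ∈? xs) ]· 1 + [ x ∈? xs ]· 1) 1 M
    ≡⟨ ∑-cong 1 M (λ x _ _ → []·-complement (x ∈? xs)) ⟩
  ∑ (const 1) 1 M
    ≡⟨ trans (∑-const 1 1 M) (*-identityʳ M) ⟩
  M ∎
  where
  open ≡-Reasoning
  M = largest xs
  range : All (λ x → 1 ≤ x × x < 1 + M) xs
  range = tabulate (λ x∈xs → All.lookup pos x∈xs , s≤s (∈⇒≤largest xs x∈xs))
  missing≡ : length (missing xs) ≡ ∑ (λ x → [ ¬? (x ∈? xs) ]· 1) 1 M
  missing≡ = trans (cong (length ∘ filter (λ x → ¬? (x ∈? xs))) (map-applyUpTo id suc M))
                   (length-filter-applyUpTo (λ x → ¬? (x ∈? xs)) suc M 1 (λ _ → refl))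

sum-by-pairs : (xs : List ℕ) {m q e : ℕ} → AllPairs _≢_ xs → All (λ x → 1 ≤ x × x ≤ m) xs → m ∈ xs →
               e ≤ 1 → m ≡ suc (q + q + e) →
               sum xs ≡ ∑ (λ a → weight xs a + weight xs (m ∸ a)) 1 q + e * weight xs (suc q) + m
sum-by-pairs xs {m} {q} {e} distinct range m∈xs e≤1 m≡ = begin
  sum xs
    ≡⟨ sum≡∑-weight xs m distinct (All.map (λ (1≤x , x≤m) → 1≤x , s≤s x≤m) range) ⟩
  ∑ (weight xs) 1 m
    ≡⟨ trans (cong (∑ (weight xs) 1) m≡) (∑-last (weight xs) 1 (q + q + e)) ⟩
  ∑ (weight xs) 1 (q + q + e) + weight xs (suc (q + q + e))
    ≡⟨ cong₂ _+_ (∑-pair (weight xs) e q 1 m e≤1 (cong suc (sym m≡)))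
                 (trans (cong (weight xs) (sym m≡)) (weight-∈ m∈xs)) ⟩
  ∑ (λ a → weight xs a + weight xs (m ∸ a)) 1 q + e * weight xs (suc q) + m ∎
  where open ≡-Reasoning

sum-complementary : (xs : List ℕ) (q : ℕ) → AllPairs _≢_ xs → All (λ x → 1 ≤ x × x ≤ suc (q + q)) xs →
  suc (q + q) ∈ xs →
  (∀ a → 1 ≤ a → a ≤ q → a ∈ xs → suc (q + q) ∸ a ∉ xs) →
  (∀ a → 1 ≤ a → a ≤ q → a ∉ xs → suc (q + q) ∸ a ∈ xs) →
  sum xs ≡ tri q + ∑ (λ a → [ ¬? (a ∈? xs) ]· (suc (q + q) ∸ (a + a))) 1 q + suc (q + q)
sum-complementary xs q distinct range top∈xs ∈⇒partner∉ ∉⇒partner∈ = begin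
  sum xs
    ≡⟨ sum-by-pairs xs {q = q} distinct range top∈xs z≤n (cong suc (sym (+-identityʳ (q + q)))) ⟩
  ∑ (λ a → weight xs a + weight xs (top ∸ a)) 1 q + 0 + top
    ≡⟨ cong (_+ top) (+-identityʳ _) ⟩
  ∑ (λ a → weight xs a + weight xs (top ∸ a)) 1 q + top
    ≡⟨ cong (_+ top) (∑-cong 1 q pair≡) ⟩
  ∑ (λ a → a + excess a) 1 q + top
    ≡⟨ cong (_+ top) (∑-distrib-+ id excess 1 q) ⟩
  tri q + ∑ excess 1 q + top ∎
  where
  open ≡-Reasoning
  top = suc (q + q)
  excess : ℕ → ℕ
  excess a = [ ¬? (a ∈? xs) ]· (top ∸ (a + a))
  pair≡ : ∀ a → 1 ≤ a → a < 1 + q → weight xs a + weight xs (top ∸ a) ≡ a + excess a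
  pair≡ a 1≤a (s≤s a≤q) with a ∈? xs
  ... | yes a∈xs = cong (a +_) (weight-∉ (∈⇒partner∉ a 1≤a a≤q a∈xs))
  ... | no a∉xs = begin
    weight xs (top ∸ a)              ≡⟨ weight-∈ (∉⇒partner∈ a 1≤a a≤q a∉xs) ⟩
    top ∸ a                          ≡⟨ cong (_∸ a) (sym (m+[n∸m]≡n 2a≤top)) ⟩
    a + a + (top ∸ (a + a)) ∸ a      ≡⟨ cong (_∸ a) (+-assoc a a _) ⟩
    a + (a + (top ∸ (a + a))) ∸ a    ≡⟨ m+n∸m≡n a _ ⟩
    a + (top ∸ (a + a))              ∎
    where
    2a≤top : a + a ≤ top
    2a≤top = ≤-trans (+-mono-≤ a≤q a≤q) (n≤1+n (q + q))

-- Unrefinable partitions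

module UnrefinablePartition (mu : List ℕ) (lin : Linked _<_ mu) (pos : All (1 ≤_) mu)
                            (largest∈mu : largest mu ∈ mu) (unrefinable : Unrefinable mu) where

  m : ℕ
  m = largest mu

  pair : ℕ → ℕ
  pair a = weight mu a + weight mu (m ∸ a)

  a≤m : ∀ a → a + a < m → a ≤ m
  a≤m a a+a<m = ≤-trans (m≤m+n a a) (<⇒≤ a+a<m)

  a<partner : ∀ a → a + a < m → a < m ∸ a
  a<partner a a+a<m = +-cancelˡ-< a a (m ∸ a) (≤-trans a+a<m (≤-reflexive (sym (m+[n∸m]≡n (a≤m a a+a<m)))))

  one-of-pair : ∀ a → 1 ≤ a → a + a < m → a ∉ mu → m ∸ a ∉ mu → ⊥
  one-of-pair a 1≤a a+a<m a∉mu partner∉mu =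
    unrefinable (a , m ∸ a , <⇒≢ (a<partner a a+a<m) , (1≤a , a≤m a a+a<m , a∉mu) ,
                 (≤-trans 1≤a (<⇒≤ (a<partner a a+a<m)) , m∸n≤m m a , partner∉mu) ,
                 subst (_∈ mu) (sym (m+[n∸m]≡n (a≤m a a+a<m))) largest∈mu)

  pair-≥ : ∀ a → 1 ≤ a → a + a < m → a ≤ pair a
  pair-≥ a 1≤a a+a<m with a ∈? mu | (m ∸ a) ∈? mu
  ... | yes _ | _ = m≤m+n a _
  ... | no _ | yes _ = <⇒≤ (a<partner a a+a<m)
  ... | no a∉mu | no partner∉mu = ⊥-elim (one-of-pair a 1≤a a+a<m a∉mu partner∉mu)

  module _ {q e : ℕ} (e≤1 : e ≤ 1) (m≡ : m ≡ suc (q + q + e)) where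

    2a<m : ∀ {a} → a ≤ q → a + a < m
    2a<m a≤q = ≤-trans (s≤s (≤-trans (+-mono-≤ a≤q a≤q) (m≤m+n (q + q) e))) (≤-reflexive (sym m≡))

    sum≡ : sum mu ≡ ∑ pair 1 q + e * weight mu (suc q) + m
    sum≡ = sum-by-pairs mu (Linked<⇒distinct lin)
             (tabulate (λ x∈mu → All.lookup pos x∈mu , ∈⇒≤largest mu x∈mu)) largest∈mu e≤1 m≡

    tri≤∑pair : tri q ≤ ∑ pair 1 q
    tri≤∑pair = ∑-mono-≤ 1 q (λ a 1≤a a<1+q → pair-≥ a 1≤a (2a<m (s≤s⁻¹ a<1+q)))

    tri+largest≤sum : tri q + m ≤ sum mu
    tri+largest≤sum = ≤-trans (+-monoˡ-≤ m (≤-trans tri≤∑pair (m≤m+n _ _))) (≤-reflexive (sym sum≡))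

  module _ {q : ℕ} (m≡ : m ≡ suc (q + q + 1)) where

    private
      sum≡pairs : sum mu ≡ ∑ pair 1 q + 1 * weight mu (suc q) + m
      sum≡pairs = sum≡ {q} (s≤s z≤n) m≡

    both-in-pair : ∀ a₀ → 1 ≤ a₀ → a₀ ≤ q → a₀ ∈ mu → m ∸ a₀ ∈ mu → tri q + suc q + m ≤ sum mu
    both-in-pair a₀ 1≤a₀ a₀≤q a₀∈mu partner∈mu =
      ≤-trans (+-monoˡ-≤ m (≤-trans bound (m≤m+n _ _))) (≤-reflexive (sym sum≡pairs))
      where
      partner≥ : suc q ≤ m ∸ a₀
      partner≥ = ≤-trans (≤-trans (n≤1+n (suc q)) (≤-reflexive (sym (trans (cong (_∸ q) (trans m≡ (split q))) (m+n∸m≡n q _)))))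
                         (∸-monoʳ-≤ m a₀≤q)
        where
        split : ∀ q → suc (q + q + 1) ≡ q + suc (suc q)
        split = solve-∀
      pointwise : ∀ a → 1 ≤ a → a < 1 + q → a + [ a ≟ a₀ ]· (m ∸ a₀) ≤ pair a
      pointwise a 1≤a a<1+q with a ≟ a₀
      ... | yes refl = ≤-reflexive (trans (cong (a₀ +_) ([]·-yes (a₀ ≟ a₀) refl))
                                          (sym (cong₂ _+_ (weight-∈ a₀∈mu) (weight-∈ partner∈mu))))
      ... | no a≢a₀ = ≤-trans (≤-reflexive (trans (cong (a +_) ([]·-no (a ≟ a₀) a≢a₀)) (+-identityʳ a)))
                              (pair-≥ a 1≤a (2a<m {q} (s≤s z≤n) m≡ (s≤s⁻¹ a<1+q)))
      bound : tri q + suc q ≤ ∑ pair 1 q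
      bound = begin
        tri q + suc q                                    ≤⟨ +-monoʳ-≤ (tri q) partner≥ ⟩
        tri q + (m ∸ a₀)                                 ≡⟨ cong (tri q +_) (∑-delta a₀ (m ∸ a₀) 1 q 1≤a₀ (s≤s a₀≤q)) ⟨
        tri q + ∑ (λ a → [ a ≟ a₀ ]· (m ∸ a₀)) 1 q       ≡⟨ ∑-distrib-+ id (λ a → [ a ≟ a₀ ]· (m ∸ a₀)) 1 q ⟨
        ∑ (λ a → a + [ a ≟ a₀ ]· (m ∸ a₀)) 1 q           ≤⟨ ∑-mono-≤ 1 q pointwise ⟩
        ∑ pair 1 q                                       ∎
        where open ≤-Reasoning

    middle-in : suc q ∈ mu → tri q + suc q + m ≤ sum mu
    middle-in mid∈mu = ≤-trans (+-monoˡ-≤ m (+-mono-≤ (tri≤∑pair {q} (s≤s z≤n) m≡) mid≤)) (≤-reflexive (sym sum≡pairs))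
      where
      mid≤ : suc q ≤ 1 * weight mu (suc q)
      mid≤ = ≤-reflexive (sym (trans (*-identityˡ _) (weight-∈ mid∈mu)))

    one-in-each-pair : (∀ a → 1 ≤ a → a ≤ q → ¬ (a ∈ mu × m ∸ a ∈ mu)) → suc q ∉ mu →
                       ∃ λ W → sum mu ≡ tri q + (W + W) + m
    one-in-each-pair not-both mid∉mu = W , (begin
      sum mu                                         ≡⟨ sum≡pairs ⟩
      ∑ pair 1 q + 1 * weight mu (suc q) + m         ≡⟨ cong₂ (λ s t → s + t + m) ∑pair≡ (trans (*-identityˡ _) (weight-∉ mid∉mu)) ⟩
      tri q + (W + W) + 0 + m                        ≡⟨ cong (_+ m) (+-identityʳ _) ⟩
      tri q + (W + W) + m                            ∎)
      where
      open ≡-Reasoning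
      w : ℕ → ℕ
      w a = [ (m ∸ a) ∈? mu ]· (suc q ∸ a)
      W = ∑ w 1 q
      pair≡ : ∀ a → 1 ≤ a → a < 1 + q → pair a ≡ a + (w a + w a)
      pair≡ a 1≤a (s≤s a≤q) with a ∈? mu | (m ∸ a) ∈? mu
      ... | yes a∈mu | yes partner∈mu = ⊥-elim (not-both a 1≤a a≤q (a∈mu , partner∈mu))
      ... | yes _ | no _ = refl
      ... | no _ | yes _ = begin
        m ∸ a                 ≡⟨ cong (_∸ a) m≡a+a+2u ⟩
        a + (a + (u + u)) ∸ a ≡⟨ m+n∸m≡n a _ ⟩
        a + (u + u)           ∎
        where
        u = suc q ∸ a
        m≡a+a+2u : m ≡ a + (a + (u + u))
        m≡a+a+2u = trans m≡ (trans (double q) (trans (cong (λ z → z + z) (sym (m+[n∸m]≡n (≤-trans a≤q (n≤1+n q))))) (regroup a u)))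
          where
          double : ∀ q → suc (q + q + 1) ≡ suc q + suc q
          double = solve-∀
          regroup : ∀ a u → a + u + (a + u) ≡ a + (a + (u + u))
          regroup = solve-∀
      ... | no a∉mu | no partner∉mu = ⊥-elim (one-of-pair a 1≤a (2a<m {q} (s≤s z≤n) m≡ a≤q) a∉mu partner∉mu)
      ∑pair≡ : ∑ pair 1 q ≡ tri q + (W + W)
      ∑pair≡ = trans (∑-cong 1 q pair≡)
                     (trans (∑-distrib-+ id (λ a → w a + w a) 1 q) (cong (tri q +_) (∑-distrib-+ w w 1 q)))

    even-largest : tri q + suc q + m ≤ sum mu ⊎ ∃ λ W → sum mu ≡ tri q + (W + W) + m
    even-largest with anyUpTo? (λ n → suc n ∈? mu ×-dec (m ∸ suc n) ∈? mu) q
    ... | yes (n , n<q , both) = inj₁ (both-in-pair (suc n) (s≤s z≤n) n<q (proj₁ both) (proj₂ both))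
    ... | no none with suc q ∈? mu
    ...   | yes mid∈mu = inj₁ (middle-in mid∈mu)
    ...   | no mid∉mu = inj₂ (one-in-each-pair not-both mid∉mu)
      where
      not-both : ∀ a → 1 ≤ a → a ≤ q → ¬ (a ∈ mu × m ∸ a ∈ mu)
      not-both (suc n) _ a≤q both = none (n , a≤q , both)

  large-largest : ∀ {q} → suc (suc (q + q)) ≤ m →
                  tri q + suc q + m ≤ sum mu ⊎ ∃ λ W → sum mu ≡ tri q + (W + W) + suc (q + q + 1)
  large-largest {q} m>2q+1 with halves (m ∸ 1)
  ... | h , e , e≤1 , m∸1≡ with q <? h
  ...   | yes q<h = inj₁ (≤-trans (+-monoˡ-≤ m tri-step) (tri+largest≤sum {h} e≤1 m≡))
    where
    m≡ : m ≡ suc (h + h + e)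
    m≡ = trans (sym (m+[n∸m]≡n (≤-trans (s≤s z≤n) m>2q+1))) (cong suc m∸1≡)
    tri-step : tri q + suc q ≤ tri h
    tri-step = ≤-trans (≤-reflexive (trans (+-comm (tri q) (suc q)) (sym (tri-suc q)))) (tri-mono-≤ q<h)
  ...   | no h≮q = by-parity e≤1 m∸1≡
    where
    1+2q≤m∸1 : suc (q + q) ≤ m ∸ 1
    1+2q≤m∸1 = ∸-monoˡ-≤ 1 m>2q+1
    by-parity : ∀ {e} → e ≤ 1 → m ∸ 1 ≡ h + h + e →
                tri q + suc q + m ≤ sum mu ⊎ ∃ λ W → sum mu ≡ tri q + (W + W) + suc (q + q + 1)
    by-parity z≤n m∸1≡ = ⊥-elim (<-irrefl refl (≤-trans 1+2q≤m∸1 (≤-trans (≤-reflexive m∸1≡)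
                           (≤-trans (≤-reflexive (+-identityʳ _)) (+-mono-≤ (≮⇒≥ h≮q) (≮⇒≥ h≮q))))))
    by-parity (s≤s z≤n) m∸1≡ = map₂ (λ (W , sum≡) → W , trans sum≡ (cong (tri q + (W + W) +_) m≡)) (even-largest {q} m≡)
      where
      q≤h : q ≤ h
      q≤h = +-double-cancel-≤ (+-cancelʳ-≤ 1 _ _ (≤-trans (≤-reflexive (+-comm (q + q) 1)) (≤-trans 1+2q≤m∸1 (≤-reflexive m∸1≡))))
      m≡ : m ≡ suc (q + q + 1)
      m≡ = trans (sym (m+[n∸m]≡n (≤-trans (s≤s z≤n) m>2q+1)))
                 (cong suc (trans m∸1≡ (cong (λ z → z + z + 1) (≤-antisym (≮⇒≥ h≮q) q≤h))))

unrefinable-largest-≤ : (q h : ℕ) (mu : List ℕ) → h + h ≤ suc q →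
  IsDistinctPartition (tri q + (h + h) + suc (q + q)) mu → Unrefinable mu → largest mu ≤ suc (q + q)
unrefinable-largest-≤ q h mu 2h≤1+q (lin , pos , 2≤len , sum≡N) unrefinable with largest mu ≤? suc (q + q)
... | yes ≤top = ≤top
... | no ≰top = ⊥-elim ([ too-big , not-odd ] (large-largest (≰⇒> ≰top)))
  where
  open UnrefinablePartition mu lin pos (largest-∈ mu (≤-trans (s≤s z≤n) 2≤len)) unrefinable
  too-big : tri q + suc q + m ≤ sum mu → ⊥
  too-big ≤sum = <-irrefl refl (begin-strict
    tri q + (h + h) + suc (q + q) <⟨ +-monoʳ-< (tri q + (h + h)) (≰⇒> ≰top) ⟩
    tri q + (h + h) + m           ≤⟨ +-monoˡ-≤ m (+-monoʳ-≤ (tri q) 2h≤1+q) ⟩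
    tri q + suc q + m             ≤⟨ ≤sum ⟩
    sum mu                        ≡⟨ sum≡N ⟩
    tri q + (h + h) + suc (q + q) ∎)
    where open ≤-Reasoning
  not-odd : ¬ (∃ λ W → sum mu ≡ tri q + (W + W) + suc (q + q + 1))
  not-odd (W , sum≡) = even≢odd h W (sym (+-cancelʳ-≡ (tri q + suc (q + q)) (suc (2 * W)) (2 * h)
                         (trans (sym (regroup₁ (tri q) W q)) (trans (sym sum≡) (trans sum≡N (regroup₂ (tri q) h q))))))
    where
    regroup₁ : ∀ t W q → t + (W + W) + suc (q + q + 1) ≡ suc (2 * W) + (t + suc (q + q))
    regroup₁ = solve-∀
    regroup₂ : ∀ t h q → t + (h + h) + suc (q + q) ≡ 2 * h + (t + suc (q + q))
    regroup₂ = solve-∀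

-- Young diagrams

colLen-∷-≤ : ∀ y Y {j} → j ≤ y → colLen (y ∷ Y) j ≡ suc (colLen Y j)
colLen-∷-≤ y Y {j} j≤y = cong length (filter-accept (j ≤?_) j≤y)

colLen-≤-length : ∀ Y j → colLen Y j ≤ length Y
colLen-≤-length Y j = length-filter (j ≤?_) Y

colLen-1 : ∀ Y → All (1 ≤_) Y → colLen Y 1 ≡ length Y
colLen-1 Y pos = cong length (filter-all (1 ≤?_) pos)

colLen-beyond-head : ∀ {y Y j} → Linked _≥_ (y ∷ Y) → y < j → colLen (y ∷ Y) j ≡ 0
colLen-beyond-head {y} {Y} {j} lin y<j =
  cong length (filter-none (j ≤?_) (All.map (λ x<j j≤x → <-irrefl refl (<-≤-trans x<j j≤x))
                                            (y<j ∷ All.map (λ x≤y → ≤-<-trans x≤y y<j) (≥-head lin))))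

≤rowLen⇔≤colLen : ∀ Y → Linked _≥_ Y → ∀ {i j} → 1 ≤ i → i ≤ length Y → j ≤ rowLen Y i ⇔ i ≤ colLen Y j
≤rowLen⇔≤colLen (y ∷ Y) lin {1} {j} _ _ = mk⇔ into back
  where
  into : j ≤ y → 1 ≤ colLen (y ∷ Y) j
  into j≤y = ≤-trans (s≤s z≤n) (≤-reflexive (sym (colLen-∷-≤ y Y j≤y)))
  back : 1 ≤ colLen (y ∷ Y) j → j ≤ y
  back 1≤col with j ≤? y
  ... | yes j≤y = j≤y
  ... | no j≰y = ⊥-elim (<-irrefl refl (≤-trans 1≤col (≤-reflexive (colLen-beyond-head lin (≰⇒> j≰y)))))
≤rowLen⇔≤colLen (y ∷ Y) lin {2+ i} {j} _ (s≤s i<len) = mk⇔ into back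
  where
  rest = ≤rowLen⇔≤colLen Y (Linked.tail lin) {suc i} {j} (s≤s z≤n) i<len
  into : j ≤ rowLen Y (suc i) → 2+ i ≤ colLen (y ∷ Y) j
  into j≤row = ≤-trans (s≤s (to rest j≤row))
                       (≤-reflexive (sym (colLen-∷-≤ y Y (≤-trans j≤row (nth-All Y (suc i) (≥-head lin) z≤n)))))
  back : 2+ i ≤ colLen (y ∷ Y) j → j ≤ rowLen Y (suc i)
  back 2+i≤col with j ≤? y
  ... | yes j≤y = from rest (s≤s⁻¹ (≤-trans 2+i≤col (≤-reflexive (colLen-∷-≤ y Y j≤y))))
  ... | no j≰y = ⊥-elim (<-irrefl refl (<-≤-trans (s≤s z≤n) (≤-trans 2+i≤col (≤-reflexive (colLen-beyond-head lin (≰⇒> j≰y))))))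

colLen-antitone : ∀ Y → Linked _≥_ Y → ∀ {j j'} → j ≤ j' → colLen Y j' ≤ colLen Y j
colLen-antitone Y lin {j} {j'} j≤j' with colLen Y j' in col≡
... | zero = z≤n
... | suc c = to (conj {j}) (≤-trans j≤j' (from (conj {j'}) (≤-reflexive (sym col≡))))
  where
  conj : ∀ {k} → k ≤ rowLen Y (suc c) ⇔ suc c ≤ colLen Y k
  conj = ≤rowLen⇔≤colLen Y lin (s≤s z≤n) (≤-trans (≤-reflexive (sym col≡)) (colLen-≤-length Y j'))

colLen-between : ∀ Y → Linked _≥_ Y → ∀ {i j} → 1 ≤ i → i ≤ length Y →
                 rowLen Y (suc i) < j → j ≤ rowLen Y i → colLen Y j ≡ i
colLen-between Y lin {i} {j} 1≤i i≤len next<j j≤row = ≤-antisym colLen≤i (to (≤rowLen⇔≤colLen Y lin 1≤i i≤len) j≤row)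
  where
  colLen≤i : colLen Y j ≤ i
  colLen≤i with colLen Y j ≤? i
  ... | yes ≤i = ≤i
  ... | no ≰i = ⊥-elim (<⇒≱ next<j (from (≤rowLen⇔≤colLen Y lin (s≤s z≤n) (≤-trans (≰⇒> ≰i) (colLen-≤-length Y j))) (≰⇒> ≰i)))

hook-firstColumn : ∀ Y → All (1 ≤_) Y → ∀ {i} → 1 ≤ i → i ≤ length Y → hook Y i 1 ≡ rowLen Y i + (length Y ∸ i)
hook-firstColumn Y pos {i} 1≤i i≤len = begin
  (rowLen Y i ∸ 1) + (colLen Y 1 ∸ i) + 1   ≡⟨ cong (λ c → (rowLen Y i ∸ 1) + (c ∸ i) + 1) (colLen-1 Y pos) ⟩
  (rowLen Y i ∸ 1) + (length Y ∸ i) + 1     ≡⟨ +-comm _ 1 ⟩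
  suc ((rowLen Y i ∸ 1) + (length Y ∸ i))   ≡⟨ cong (_+ (length Y ∸ i)) (m+[n∸m]≡n (nth-positive Y pos i 1≤i i≤len)) ⟩
  rowLen Y i + (length Y ∸ i)               ∎
  where open ≡-Reasoning

hookPartition≡applyDownFrom : ∀ Y → hookPartition Y ≡ applyDownFrom (λ i → hook Y (suc i) 1) (length Y)
hookPartition≡applyDownFrom Y =
  trans (cong reverse (map-applyUpTo id (λ i → hook Y (suc i) 1) (length Y)))
        (reverse-applyUpTo (λ i → hook Y (suc i) 1) (length Y))

hookPartition-increasing : ∀ Y → IsYoungDiagram Y → Linked _<_ (hookPartition Y)
hookPartition-increasing Y (pos , lin) =
  subst (Linked _<_) (sym (hookPartition≡applyDownFrom Y)) (applyDownFrom⁺₁ (λ i → hook Y (suc i) 1) (length Y) step)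
  where
  step : ∀ {i} → suc i < length Y → hook Y (2+ i) 1 < hook Y (suc i) 1
  step {i} 2+i≤len = begin-strict
    hook Y (2+ i) 1                               ≡⟨ hook-firstColumn Y pos (s≤s z≤n) 2+i≤len ⟩
    rowLen Y (2+ i) + (length Y ∸ 2+ i)            ≤⟨ +-monoˡ-≤ _ (nth-antitone Y lin (s≤s z≤n) (n≤1+n (suc i))) ⟩
    rowLen Y (suc i) + (length Y ∸ 2+ i)           <⟨ +-monoʳ-< (rowLen Y (suc i)) (∸-monoʳ-< ≤-refl 2+i≤len) ⟩
    rowLen Y (suc i) + (length Y ∸ suc i)          ≡⟨ hook-firstColumn Y pos (s≤s z≤n) (<⇒≤ 2+i≤len) ⟨
    hook Y (suc i) 1                              ∎
    where open ≤-Reasoning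

module BalancedDiagram (Y : List ℕ) (young : IsYoungDiagram Y) (r : ℕ)
    (durfee : InY Y r r) (beyond-durfee : ¬ InY Y (suc r) (suc r))
    (balanced : ∀ i → 1 ≤ i → i ≤ r → arm Y i i ≡ leg Y i i) where

  private
    pos = proj₁ young
    lin = proj₂ young
    1≤r = proj₁ durfee

  L : ℕ
  L = length Y

  a : ℕ → ℕ
  a j = arm Y j j

  r≤L : r ≤ L
  r≤L with r ≤? L
  ... | yes r≤L = r≤L
  ... | no r≰L = ⊥-elim (<-irrefl refl (≤-trans 1≤r (≤-trans (proj₂ (proj₂ durfee)) (≤-reflexive (nth-beyond Y r (≰⇒> r≰L))))))

  conjugate : ∀ {i j} → 1 ≤ i → i ≤ L → j ≤ rowLen Y i ⇔ i ≤ colLen Y j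
  conjugate = ≤rowLen⇔≤colLen Y lin

  module _ {j : ℕ} (1≤j : 1 ≤ j) (j≤r : j ≤ r) where

    rowLen-diagonal : rowLen Y j ≡ j + a j
    rowLen-diagonal = sym (m+[n∸m]≡n (≤-trans j≤r (≤-trans (proj₂ (proj₂ durfee)) (nth-antitone Y lin 1≤j j≤r))))

    colLen-diagonal : colLen Y j ≡ j + a j
    colLen-diagonal = trans (sym (m+[n∸m]≡n j≤colLen)) (cong (j +_) (sym (balanced j 1≤j j≤r)))
      where
      j≤colLen : j ≤ colLen Y j
      j≤colLen = to (conjugate 1≤j (≤-trans j≤r r≤L)) (≤-trans (m≤m+n j (a j)) (≤-reflexive (sym rowLen-diagonal)))

    hook-diagonal : hook Y j j ≡ a j + a j + 1
    hook-diagonal = cong (λ l → a j + l + 1) (sym (balanced j 1≤j j≤r))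

  L≡ : L ≡ suc (a 1)
  L≡ = trans (sym (colLen-1 Y pos)) (colLen-diagonal (s≤s z≤n) 1≤r)

  rowLen-below : ∀ {i} → r < i → rowLen Y i ≤ r
  rowLen-below {i} r<i = ≤-trans (nth-antitone Y lin (s≤s z≤n) r<i) next≤r
    where
    next≤r : rowLen Y (suc r) ≤ r
    next≤r with suc r ≤? rowLen Y (suc r)
    ... | yes inside = ⊥-elim (beyond-durfee (s≤s z≤n , s≤s z≤n , inside))
    ... | no outside = s≤s⁻¹ (≰⇒> outside)

  DiagonalArm : ℕ → Set
  DiagonalArm b = ∃ λ j → 1 ≤ j × j ≤ r × a j ≡ b

  -- The two alternatives are the hooks of the rows through, and of the rows below, the Durfee square.
  FirstColumnHook : ℕ → Set
  FirstColumnHook x = (∃ λ b → DiagonalArm b × x ≡ suc (a 1 + b))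
                    ⊎ (1 ≤ x × x ≤ a 1 × ¬ (∃ λ b → DiagonalArm b × x + b ≡ a 1))

  hook-above : ∀ {i} → 1 ≤ i → i ≤ r → hook Y i 1 ≡ suc (a 1 + a i)
  hook-above {i} 1≤i i≤r = begin
    hook Y i 1             ≡⟨ hook-firstColumn Y pos 1≤i i≤L ⟩
    rowLen Y i + (L ∸ i)   ≡⟨ cong (_+ (L ∸ i)) (rowLen-diagonal 1≤i i≤r) ⟩
    i + a i + (L ∸ i)      ≡⟨ +-comm-right i (a i) (L ∸ i) ⟩
    i + (L ∸ i) + a i      ≡⟨ cong (_+ a i) (trans (m+[n∸m]≡n i≤L) L≡) ⟩
    suc (a 1 + a i)        ∎
    where
    open ≡-Reasoning
    i≤L = ≤-trans i≤r r≤L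
    +-comm-right : ∀ x y z → x + y + z ≡ x + z + y
    +-comm-right = solve-∀

  module _ {i : ℕ} (r<i : r < i) (i≤L : i ≤ L) where

    private
      y = rowLen Y i
      t = L ∸ i
      L≡i+t : L ≡ i + t
      L≡i+t = sym (m+[n∸m]≡n i≤L)

    hook-below : hook Y i 1 ≡ y + t
    hook-below = hook-firstColumn Y pos (≤-trans (s≤s z≤n) r<i) i≤L

    hook-below-≤ : hook Y i 1 ≤ a 1
    hook-below-≤ = s≤s⁻¹ (begin
      suc (hook Y i 1)  ≡⟨ cong suc hook-below ⟩
      suc (y + t)       ≤⟨ +-monoˡ-≤ t (≤-trans (s≤s (rowLen-below r<i)) r<i) ⟩
      i + t             ≡⟨ trans (sym L≡i+t) L≡ ⟩
      suc (a 1)         ∎)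
      where open ≤-Reasoning

    private
      i≥1 : 1 ≤ i
      i≥1 = ≤-trans (s≤s z≤n) r<i
      gap-equation : ∀ {j} → hook Y i 1 + a j ≡ a 1 → suc (y + a j) ≡ i
      gap-equation {j} h+aj≡a1 = +-cancelʳ-≡ t _ _ (begin
        suc (y + a j) + t ≡⟨ regroup y (a j) t ⟩
        suc (y + t + a j) ≡⟨ cong suc (trans (cong (_+ a j) (sym hook-below)) h+aj≡a1) ⟩
        suc (a 1)         ≡⟨ sym L≡ ⟩
        L                 ≡⟨ L≡i+t ⟩
        i + t             ∎)
        where
        open ≡-Reasoning
        regroup : ∀ y a t → suc (y + a) + t ≡ suc (y + t + a)
        regroup = solve-∀

    hook-below-gap : ∀ {j} → 1 ≤ j → j ≤ r → hook Y i 1 + a j ≢ a 1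
    hook-below-gap {j} 1≤j j≤r h+aj≡a1 with j ≤? y
    ... | yes j≤y = <-irrefl refl (begin-strict
      i                 ≤⟨ to (conjugate i≥1 i≤L) j≤y ⟩
      colLen Y j        ≡⟨ colLen-diagonal 1≤j j≤r ⟩
      j + a j           ≤⟨ +-monoˡ-≤ (a j) j≤y ⟩
      y + a j           <⟨ ≤-reflexive (gap-equation {j} h+aj≡a1) ⟩
      i                 ∎)
      where open ≤-Reasoning
    ... | no j≰y = <-irrefl refl (from (conjugate i≥1 i≤L) (begin
      i                 ≡⟨ sym (gap-equation {j} h+aj≡a1) ⟩
      suc y + a j       ≤⟨ +-monoˡ-≤ (a j) (≰⇒> j≰y) ⟩
      j + a j           ≡⟨ sym (colLen-diagonal 1≤j j≤r) ⟩
      colLen Y j        ≤⟨ colLen-antitone Y lin (≰⇒> j≰y) ⟩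
      colLen Y (suc y)  ∎))
      where open ≤-Reasoning

  arm-≤ : ∀ {j} → 1 ≤ j → j ≤ r → a j ≤ a 1
  arm-≤ {j} 1≤j j≤r = ∸-mono (nth-antitone Y lin (s≤s z≤n) 1≤j) 1≤j

  private
    crossing : ∀ {x} → x ≤ a 1 → ∃ λ i → r ≤ i × i ≤ L × x ≤ rowLen Y i + (L ∸ i) × rowLen Y (suc i) + (L ∸ i) ≤ x
    crossing {x} x≤a1 with boundary Q? r (suc L ∸ r) Qr ¬Qend
      where
      Q : ℕ → Set
      Q i = suc x ≤ rowLen Y i + (suc L ∸ i)
      Q? : ∀ i → Dec (Q i)
      Q? i = suc x ≤? rowLen Y i + (suc L ∸ i)
      r+[1+L∸r]≡1+L : r + (suc L ∸ r) ≡ suc L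
      r+[1+L∸r]≡1+L = m+[n∸m]≡n (≤-trans r≤L (n≤1+n L))
      Qr : Q r
      Qr = begin
        suc x                     ≤⟨ s≤s x≤a1 ⟩
        suc (a 1)                 ≡⟨ sym L≡ ⟩
        L                         ≤⟨ n≤1+n L ⟩
        suc L                     ≡⟨ sym r+[1+L∸r]≡1+L ⟩
        r + (suc L ∸ r)           ≤⟨ +-monoˡ-≤ (suc L ∸ r) (proj₂ (proj₂ durfee)) ⟩
        rowLen Y r + (suc L ∸ r)  ∎
        where open ≤-Reasoning
      ¬Qend : ¬ Q (r + (suc L ∸ r))
      ¬Qend Qend with subst Q r+[1+L∸r]≡1+L Qend
      ... | Q1+L rewrite nth-beyond Y (suc L) ≤-refl | n∸n≡0 L = <-irrefl refl (<-≤-trans z<s Q1+L)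
    ... | i , r≤i , i<end , Qi , ¬Qi+1 = i , r≤i , i≤L , x≤ , s≤s⁻¹ (≰⇒> ¬Qi+1)
      where
      i≤L : i ≤ L
      i≤L = s≤s⁻¹ (≤-trans i<end (≤-reflexive (m+[n∸m]≡n (≤-trans r≤L (n≤1+n L)))))
      x≤ : x ≤ rowLen Y i + (L ∸ i)
      x≤ = s≤s⁻¹ (≤-trans Qi (≤-reflexive (trans (cong (rowLen Y i +_) (+-∸-assoc 1 i≤L)) (+-suc (rowLen Y i) (L ∸ i)))))

  hook-below-cover : ∀ {x} → 1 ≤ x → x ≤ a 1 → ¬ (∃ λ b → DiagonalArm b × x + b ≡ a 1) →
                     ∃ λ i → 1 ≤ i × i ≤ L × hook Y i 1 ≡ x
  hook-below-cover {x} 1≤x x≤a1 no-gap with crossing x≤a1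
  ... | i , r≤i , i≤L , x≤y+t , y'+t≤x with x ≟ rowLen Y i + (L ∸ i)
  ...   | yes x≡ = i , 1≤i , i≤L , trans (hook-firstColumn Y pos 1≤i i≤L) (sym x≡)
    where
    1≤i = ≤-trans 1≤r r≤i
  ...   | no x≢ = ⊥-elim (no-gap (a j , (j , s≤s z≤n , j≤r , refl) , x+aj≡a1))
    where
    1≤i = ≤-trans 1≤r r≤i
    t = L ∸ i
    t≤x : t ≤ x
    t≤x = ≤-trans (m≤n+m t (rowLen Y (suc i))) y'+t≤x
    s = x ∸ t
    j = suc s
    j+t≡1+x : j + t ≡ suc x
    j+t≡1+x = cong suc (trans (+-comm s t) (m+[n∸m]≡n t≤x))
    j≤row : j ≤ rowLen Y i
    j≤row = +-cancelʳ-≤ t j _ (≤-trans (≤-reflexive j+t≡1+x) (≤∧≢⇒< x≤y+t x≢))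
    row'<j : rowLen Y (suc i) < j
    row'<j = s≤s (+-cancelʳ-≤ t _ s (≤-trans y'+t≤x (≤-reflexive (sym (m∸n+n≡m t≤x)))))
    j≤r : j ≤ r
    j≤r with m≤n⇒m<n∨m≡n r≤i
    ... | inj₁ r<i = ≤-trans j≤row (rowLen-below r<i)
    ... | inj₂ r≡i = +-cancelʳ-≤ t j r (≤-trans (≤-reflexive j+t≡1+x)
                       (≤-trans (s≤s x≤a1) (≤-reflexive (sym (trans (cong (_+ t) r≡i) (trans (m+[n∸m]≡n i≤L) L≡))))))
    x+aj≡a1 : x + a j ≡ a 1
    x+aj≡a1 = suc-injective (begin
      suc x + a j    ≡⟨ cong (_+ a j) j+t≡1+x ⟨
      j + t + a j    ≡⟨ +-comm-right j t (a j) ⟩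
      j + a j + t    ≡⟨ cong (_+ t) (trans (sym (colLen-diagonal (s≤s z≤n) j≤r)) (colLen-between Y lin 1≤i i≤L row'<j j≤row)) ⟩
      i + t          ≡⟨ trans (m+[n∸m]≡n i≤L) L≡ ⟩
      suc (a 1)      ∎)
      where
      open ≡-Reasoning
      +-comm-right : ∀ x y z → x + y + z ≡ x + z + y
      +-comm-right = solve-∀

  hook∈hookPartition : ∀ {i} → 1 ≤ i → i ≤ L → hook Y i 1 ∈ hookPartition Y
  hook∈hookPartition {suc i} _ i<L =
    subst (hook Y (suc i) 1 ∈_) (sym (hookPartition≡applyDownFrom Y)) (∈-applyDownFrom⁺ (λ i → hook Y (suc i) 1) i<L)

  ∈hookPartition⇒ : ∀ {x} → x ∈ hookPartition Y → FirstColumnHook x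
  ∈hookPartition⇒ {x} x∈ with ∈-applyDownFrom⁻ (λ i → hook Y (suc i) 1) (subst (x ∈_) (hookPartition≡applyDownFrom Y) x∈)
  ... | i , i<L , refl with suc i ≤? r
  ...   | yes i<r = inj₁ (a (suc i) , (suc i , s≤s z≤n , i<r , refl) , hook-above (s≤s z≤n) i<r)
  ...   | no i≮r = inj₂ (m≤n+m 1 _ , hook-below-≤ (≰⇒> i≮r) i<L ,
                        λ (b , (j , 1≤j , j≤r , aj≡b) , h+b≡a1) →
                          hook-below-gap (≰⇒> i≮r) i<L 1≤j j≤r (trans (cong (hook Y (suc i) 1 +_) aj≡b) h+b≡a1))

  ⇒∈hookPartition : ∀ {x} → FirstColumnHook x → x ∈ hookPartition Y
  ⇒∈hookPartition (inj₁ (b , (j , 1≤j , j≤r , refl) , x≡)) =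
    subst (_∈ hookPartition Y) (trans (hook-above 1≤j j≤r) (sym x≡)) (hook∈hookPartition 1≤j (≤-trans j≤r r≤L))
  ⇒∈hookPartition (inj₂ (1≤x , x≤a1 , no-gap)) with hook-below-cover 1≤x x≤a1 no-gap
  ... | i , 1≤i , i≤L , h≡x = subst (_∈ hookPartition Y) h≡x (hook∈hookPartition 1≤i i≤L)


  top : ℕ
  top = suc (a 1 + a 1)

  top∈hookPartition : top ∈ hookPartition Y
  top∈hookPartition = ⇒∈hookPartition (inj₁ (a 1 , (1 , s≤s z≤n , 1≤r , refl) , refl))

  hookPartition-range : ∀ {x} → x ∈ hookPartition Y → 1 ≤ x × x ≤ top
  hookPartition-range x∈ with ∈hookPartition⇒ x∈
  ... | inj₁ (b , (j , 1≤j , j≤r , refl) , refl) = s≤s z≤n , s≤s (+-monoʳ-≤ (a 1) (arm-≤ 1≤j j≤r))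
  ... | inj₂ (1≤x , x≤a1 , _) = 1≤x , ≤-trans x≤a1 (≤-trans (m≤m+n (a 1) (a 1)) (n≤1+n _))

  largest-hookPartition : largest (hookPartition Y) ≡ top
  largest-hookPartition = ≤-antisym (largest-≤ (hookPartition Y) (tabulate (proj₂ ∘ hookPartition-range)))
                                    (∈⇒≤largest (hookPartition Y) top∈hookPartition)

  length-hookPartition : length (hookPartition Y) ≡ suc (a 1)
  length-hookPartition = trans (cong length (hookPartition≡applyDownFrom Y))
                               (trans (length-applyDownFrom (λ i → hook Y (suc i) 1) L) L≡)

  length-missing-hookPartition : length (missing (hookPartition Y)) ≡ largest (hookPartition Y) / 2
  length-missing-hookPartition = begin
    length (missing (hookPartition Y))
      ≡⟨ +-cancelʳ-≡ (suc (a 1)) _ _ (begin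
           length (missing (hookPartition Y)) + suc (a 1)
             ≡⟨ cong (length (missing (hookPartition Y)) +_) (sym length-hookPartition) ⟩
           length (missing (hookPartition Y)) + length (hookPartition Y)
             ≡⟨ length-missing (hookPartition Y) (hookPartition-increasing Y young) (tabulate (proj₁ ∘ hookPartition-range)) ⟩
           largest (hookPartition Y)
             ≡⟨ largest-hookPartition ⟩
           top
             ≡⟨ sym (+-suc (a 1) (a 1)) ⟩
           a 1 + suc (a 1) ∎) ⟩
    a 1
      ≡⟨ sym (half-odd (a 1)) ⟩
    top / 2
      ≡⟨ cong (_/ 2) (sym largest-hookPartition) ⟩
    largest (hookPartition Y) / 2 ∎
    where open ≡-Reasoning

  private
    top∸x≡ : ∀ {x b} → x + b ≡ a 1 → top ∸ x ≡ suc (a 1 + b)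
    top∸x≡ {x} {b} x+b≡a1 = trans (cong (λ z → suc (a 1 + z) ∸ x) (sym x+b≡a1))
                                  (trans (cong (_∸ x) (regroup (a 1) x b)) (m+n∸m≡n x _))
      where
      regroup : ∀ a x b → suc (a + (x + b)) ≡ x + suc (a + b)
      regroup = solve-∀

    x+b≡ : ∀ {x b} → x ≤ a 1 → top ∸ x ≡ suc (a 1 + b) → x + b ≡ a 1
    x+b≡ {x} {b} x≤a1 top∸x≡ = +-cancelˡ-≡ (a 1) _ _ (suc-injective (begin
      suc (a 1 + (x + b))   ≡⟨ regroup (a 1) x b ⟩
      x + suc (a 1 + b)     ≡⟨ cong (x +_) (sym top∸x≡) ⟩
      x + (top ∸ x)         ≡⟨ m+[n∸m]≡n (≤-trans x≤a1 (≤-trans (m≤n+m (a 1) (a 1)) (n≤1+n _))) ⟩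
      top                   ∎))
      where
      open ≡-Reasoning
      regroup : ∀ a x b → suc (a + (x + b)) ≡ x + suc (a + b)
      regroup = solve-∀

    ∈⇒partner∉ : ∀ x → 1 ≤ x → x ≤ a 1 → x ∈ hookPartition Y → top ∸ x ∉ hookPartition Y
    ∈⇒partner∉ x 1≤x x≤a1 x∈ partner∈ with ∈hookPartition⇒ x∈ | ∈hookPartition⇒ partner∈
    ... | inj₁ (_ , _ , x≡) | _ = <-irrefl refl (≤-trans (s≤s (m≤m+n (a 1) _)) (≤-trans (≤-reflexive (sym x≡)) x≤a1))
    ... | inj₂ (_ , _ , no-gap) | inj₁ (b , arm , top∸x≡) = no-gap (b , arm , x+b≡ x≤a1 top∸x≡)
    ... | inj₂ _ | inj₂ (_ , partner≤a1 , _) = <-irrefl refl (begin-strict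
      a 1               <⟨ n<1+n (a 1) ⟩
      suc (a 1)         ≡⟨ sym (m+n∸m≡n (a 1) (suc (a 1))) ⟩
      a 1 + suc (a 1) ∸ a 1 ≡⟨ cong (_∸ a 1) (+-suc (a 1) (a 1)) ⟩
      top ∸ a 1         ≤⟨ ∸-monoʳ-≤ top x≤a1 ⟩
      top ∸ x           ≤⟨ partner≤a1 ⟩
      a 1               ∎)
      where open ≤-Reasoning

    ∉⇒partner∈ : ∀ x → 1 ≤ x → x ≤ a 1 → x ∉ hookPartition Y → top ∸ x ∈ hookPartition Y
    ∉⇒partner∈ x 1≤x x≤a1 x∉ = decidable-stable (top ∸ x ∈? hookPartition Y) λ partner∉ →
      x∉ (⇒∈hookPartition (inj₂ (1≤x , x≤a1 , λ (b , arm , x+b≡a1) →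
        partner∉ (⇒∈hookPartition (inj₁ (b , arm , top∸x≡ x+b≡a1))))))

  -- Every x ≤ a₁ pairs with top ∸ x, and exactly one of the two is a part.
  sum-hookPartition : sum (hookPartition Y) ≡ tri (a 1) + ∑ (λ x → [ ¬? (x ∈? hookPartition Y) ]· (top ∸ (x + x))) 1 (a 1) + top
  sum-hookPartition = sum-complementary (hookPartition Y) (a 1)
    (Linked<⇒distinct (hookPartition-increasing Y young)) (tabulate hookPartition-range) top∈hookPartition
    ∈⇒partner∉ ∉⇒partner∈

-- The diagram Y_{η*}

module DiagramOfEta (q k : ℕ) (1≤k : 1 ≤ k) (2k<q : k + k < q)
    (eta : List ℕ) (eta-increasing : Linked _<_ eta) (eta-positive : All (1 ≤_) eta) (sum-eta : sum eta ≡ 2 * k + 2)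
    (exceptional : q ≡ k + k + 1 → eta ≢ 1 ∷ (2 * k + 1) ∷ [])
    (Y : List ℕ) (young : IsYoungDiagram Y)
    (durfee : InY Y (length eta + 1) (length eta + 1)) (beyond-durfee : ¬ InY Y (length eta + 2) (length eta + 2))
    (corner-hook : hook Y 1 1 ≡ suc (q + q))
    (diagonal-hooks : (i : ℕ) → 2 ≤ i → i ≤ length eta + 1 → hook Y i i ≡ nth eta (length eta ∸ (i ∸ 2)))
    (balanced : (i : ℕ) → 1 ≤ i → i ≤ length eta + 1 → arm Y i i ≡ leg Y i i) where

  open BalancedDiagram Y young (length eta + 1) durfee (subst (λ i → ¬ InY Y i i) (+-suc (length eta) 1) beyond-durfee)
                       balanced public

  private
    l = length eta
    sum-eta′ : sum eta ≡ k + k + 2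
    sum-eta′ = trans sum-eta (shape k)
      where
      shape : ∀ k → 2 * k + 2 ≡ k + k + 2
      shape = solve-∀

  a₁≡q : a 1 ≡ q
  a₁≡q = +-double-injective (+-cancelʳ-≡ 1 _ _ (trans (sym (hook-diagonal (s≤s z≤n) (proj₁ durfee))) (trans corner-hook (+-comm 1 (q + q)))))

  EtaArm : ℕ → Set
  EtaArm b = b + b + 1 ∈ eta

  lower-arm-∈ : ∀ {j} → 2 ≤ j → j ≤ l + 1 → EtaArm (a j)
  lower-arm-∈ {1} (s≤s ()) _
  lower-arm-∈ {2+ j} 2≤j j≤r =
    subst (_∈ eta) (trans (sym (diagonal-hooks (2+ j) 2≤j j≤r)) (hook-diagonal (s≤s z≤n) j≤r))
          (nth-∈ eta (l ∸ j) (m<n⇒0<n∸m j<l) (m∸n≤m l j))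
    where
    j<l : j < l
    j<l = s≤s⁻¹ (≤-trans j≤r (≤-reflexive (+-comm l 1)))

  ∈eta⇒lower-arm : ∀ {η} → η ∈ eta → ∃ λ j → 2 ≤ j × j ≤ l + 1 × a j + a j + 1 ≡ η
  ∈eta⇒lower-arm η∈ with ∈⇒nth eta η∈
  ... | t , (1≤t , t≤l) , nth≡η = 2+ (l ∸ t) , s≤s (s≤s z≤n) , j≤r ,
        trans (sym (hook-diagonal (s≤s z≤n) j≤r)) (trans (diagonal-hooks _ (s≤s (s≤s z≤n)) j≤r) (trans (cong (nth eta) (m∸[m∸n]≡n t≤l)) nth≡η))
    where
    j≤r : 2+ (l ∸ t) ≤ l + 1
    j≤r = ≤-trans (s≤s (∸-monoʳ-< {o = 0} 1≤t t≤l)) (≤-reflexive (+-comm 1 l))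

  EtaArm⇒DiagonalArm : ∀ {b} → EtaArm b → DiagonalArm b
  EtaArm⇒DiagonalArm b∈ with ∈eta⇒lower-arm b∈
  ... | j , 2≤j , j≤r , 2aj+1≡ = j , ≤-trans (s≤s z≤n) 2≤j , j≤r , +-double-injective (+-cancelʳ-≡ 1 _ _ 2aj+1≡)

  DiagonalArm⇒≡q⊎EtaArm : ∀ {b} → DiagonalArm b → b ≡ q ⊎ EtaArm b
  DiagonalArm⇒≡q⊎EtaArm (1 , _ , _ , refl) = inj₁ a₁≡q
  DiagonalArm⇒≡q⊎EtaArm (2+ j , _ , j≤r , refl) = inj₂ (lower-arm-∈ (s≤s (s≤s z≤n)) j≤r)

  EtaArm-≤ : ∀ {b} → EtaArm b → b ≤ k
  EtaArm-≤ {b} b∈ with b ≤? k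
  ... | yes b≤k = b≤k
  ... | no b≰k = ⊥-elim (<-irrefl refl (begin-strict
    k + k + 2           <⟨ ≤-reflexive (regroup k) ⟩
    suc k + suc k + 1   ≤⟨ +-monoˡ-≤ 1 (+-mono-≤ (≰⇒> b≰k) (≰⇒> b≰k)) ⟩
    b + b + 1           ≤⟨ ∈⇒≤sum eta b∈ ⟩
    sum eta             ≡⟨ sum-eta′ ⟩
    k + k + 2           ∎))
    where
    open ≤-Reasoning
    regroup : ∀ k → suc (k + k + 2) ≡ suc k + suc k + 1
    regroup = solve-∀

  private
    odd-injective : ∀ {a b} → a ≢ b → a + a + 1 ≢ b + b + 1
    odd-injective a≢b = a≢b ∘ +-double-injective ∘ +-cancelʳ-≡ 1 _ _

  EtaArm-pair : ∀ {a b} → EtaArm a → EtaArm b → a ≢ b → a + b ≤ k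
  EtaArm-pair {a} {b} a∈ b∈ a≢b = +-double-cancel-≤ (+-cancelʳ-≤ 2 _ _ (begin
    a + b + (a + b) + 2        ≡⟨ regroup a b ⟩
    a + a + 1 + (b + b + 1)    ≤⟨ two-∈⇒≤sum eta a∈ b∈ (odd-injective a≢b) ⟩
    sum eta                    ≡⟨ sum-eta′ ⟩
    k + k + 2                  ∎))
    where
    open ≤-Reasoning
    regroup : ∀ a b → a + b + (a + b) + 2 ≡ a + a + 1 + (b + b + 1)
    regroup = solve-∀

  EtaArm-triple : ∀ {a b c} → EtaArm a → EtaArm b → EtaArm c → a ≢ b → a ≢ c → b ≢ c →
                  a + b + c + (a + b + c) + 3 ≤ k + k + 2
  EtaArm-triple {a} {b} {c} a∈ b∈ c∈ a≢b a≢c b≢c = begin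
    a + b + c + (a + b + c) + 3            ≡⟨ regroup a b c ⟩
    a + a + 1 + (b + b + 1) + (c + c + 1)  ≤⟨ three-∈⇒≤sum eta a∈ b∈ c∈ (odd-injective a≢b) (odd-injective a≢c) (odd-injective b≢c) ⟩
    sum eta                                ≡⟨ sum-eta′ ⟩
    k + k + 2                              ∎
    where
    open ≤-Reasoning
    regroup : ∀ a b c → a + b + c + (a + b + c) + 3 ≡ a + a + 1 + (b + b + 1) + (c + c + 1)
    regroup = solve-∀

  -- This is the one place where η = (1, 2k + 1) with 2k = n − 4 has to be excluded.
  not-exceptional : ∀ {a b} → EtaArm a → EtaArm b → a + b ≤ k → suc (a + b + a) ≡ q → ⊥
  not-exceptional {a} {b} a∈ b∈ a+b≤k 1+2a+b≡q = exceptional q≡2k+1 eta≡[1,2k+1]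
    where
    2k≤a+b+a : k + k ≤ a + b + a
    2k≤a+b+a = s≤s⁻¹ (≤-trans 2k<q (≤-reflexive (sym 1+2a+b≡q)))
    b≡0 : b ≡ 0
    b≡0 = n≤0⇒n≡0 (+-cancelˡ-≤ (a + b + a) b 0 (begin
      a + b + a + b       ≡⟨ regroup a b ⟩
      a + b + (a + b)     ≤⟨ +-mono-≤ a+b≤k a+b≤k ⟩
      k + k               ≤⟨ 2k≤a+b+a ⟩
      a + b + a           ≡⟨ +-identityʳ _ ⟨
      a + b + a + 0       ∎))
      where
      open ≤-Reasoning
      regroup : ∀ a b → a + b + a + b ≡ a + b + (a + b)
      regroup = solve-∀
    a≡k : a ≡ k
    a≡k = ≤-antisym (≤-trans (m≤m+n a b) a+b≤k)
                    (+-double-cancel-≤ (≤-trans 2k≤a+b+a (≤-reflexive (trans (cong (λ z → a + z + a) b≡0) (cong (_+ a) (+-identityʳ a))))))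
    q≡2k+1 : q ≡ k + k + 1
    q≡2k+1 = trans (sym 1+2a+b≡q) (trans (cong₂ (λ x y → suc (x + y + x)) a≡k b≡0) (regroup k))
      where
      regroup : ∀ k → suc (k + 0 + k) ≡ k + k + 1
      regroup = solve-∀
    eta≡[1,2k+1] : eta ≡ 1 ∷ (2 * k + 1) ∷ []
    eta≡[1,2k+1] = sum≡1+m⇒≡[1,m] eta eta-increasing eta-positive
      (subst EtaArm b≡0 b∈) (subst (_∈ eta) (trans (cong (λ x → x + x + 1) a≡k) (double k)) a∈)
      (λ 2k+1≡1 → <-irrefl refl (≤-trans (s≤s (≤-trans 1≤k (m≤m+n k _))) (≤-reflexive (trans (+-comm 1 (2 * k)) 2k+1≡1))))
      (trans sum-eta′ (regroup k))
      where
      double : ∀ k → k + k + 1 ≡ 2 * k + 1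
      double = solve-∀
      regroup : ∀ k → k + k + 2 ≡ 1 + (2 * k + 1)
      regroup = solve-∀

  part-cases : ∀ {x} → x ∈ hookPartition Y → x ≡ suc (q + q) ⊎ (∃ λ c → EtaArm c × x ≡ suc (q + c)) ⊎ x ≤ q
  part-cases x∈ with ∈hookPartition⇒ x∈
  ... | inj₁ (b , arm , x≡) with DiagonalArm⇒≡q⊎EtaArm arm
  ...   | inj₁ refl = inj₁ (trans x≡ (cong (λ z → suc (z + q)) a₁≡q))
  ...   | inj₂ b∈ = inj₂ (inj₁ (b , b∈ , trans x≡ (cong (λ z → suc (z + b)) a₁≡q)))
  part-cases x∈ | inj₂ (_ , x≤a₁ , _) = inj₂ (inj₂ (≤-trans x≤a₁ (≤-reflexive a₁≡q)))

  part-≤ : ∀ {x} → x ∈ hookPartition Y → x ≤ suc (q + q)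
  part-≤ x∈ = ≤-trans (proj₂ (hookPartition-range x∈)) (≤-reflexive (cong (λ z → suc (z + z)) a₁≡q))

  small-missing : ∀ {x} → 1 ≤ x → x ≤ q → x ∉ hookPartition Y → ¬ ¬ (∃ λ b → EtaArm b × x + b ≡ q)
  small-missing {x} 1≤x x≤q x∉ no-arm = x∉ (⇒∈hookPartition (inj₂ (1≤x , ≤-trans x≤q (≤-reflexive (sym a₁≡q)) , gap)))
    where
    gap : ¬ (∃ λ b → DiagonalArm b × x + b ≡ a 1)
    gap (b , arm , x+b≡a₁) with DiagonalArm⇒≡q⊎EtaArm arm
    ... | inj₁ refl = <-irrefl refl (≤-trans (+-monoˡ-≤ q 1≤x) (≤-reflexive (trans x+b≡a₁ a₁≡q)))
    ... | inj₂ b∈ = no-arm (b , b∈ , trans x+b≡a₁ a₁≡q)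

  large-missing : ∀ {x c} → x ∉ hookPartition Y → EtaArm c → x ≢ suc (q + c)
  large-missing {c = c} x∉ c∈ x≡ =
    x∉ (⇒∈hookPartition (inj₁ (c , EtaArm⇒DiagonalArm c∈ , trans x≡ (cong (λ z → suc (z + c)) (sym a₁≡q)))))

  private
    k<q : k < q
    k<q = ≤-trans (s≤s (m≤n+m k k)) 2k<q

    small+small : ∀ {x y a b} → x + a ≡ q → EtaArm a → y + b ≡ q → EtaArm b → x ≢ y → x + y ∉ hookPartition Y
    small+small {x} {y} {a} {b} x+a≡q a∈ y+b≡q b∈ x≢y x+y∈ = by-cases (part-cases x+y∈)
      where
      open ≤-Reasoning
      a≢b : a ≢ b
      a≢b a≡b = x≢y (+-cancelʳ-≡ a x y (trans x+a≡q (sym (trans (cong (y +_) a≡b) y+b≡q))))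
      a+b≤k : a + b ≤ k
      a+b≤k = EtaArm-pair a∈ b∈ a≢b
      sum≡2q : x + y + (a + b) ≡ q + q
      sum≡2q = trans (regroup x y a b) (cong₂ _+_ x+a≡q y+b≡q)
        where
        regroup : ∀ x y a b → x + y + (a + b) ≡ x + a + (y + b)
        regroup = solve-∀
      three-arms : ∀ {c} → EtaArm c → suc (a + b + c) ≡ q → ⊥
      three-arms {c} c∈ 1+a+b+c≡q with c ≟ a | c ≟ b
      ... | yes refl | _ = not-exceptional {a} {b} a∈ b∈ a+b≤k 1+a+b+c≡q
      ... | no _ | yes refl = not-exceptional {b} {a} b∈ a∈ (≤-trans (≤-reflexive (+-comm b a)) a+b≤k)
                                              (trans (cong (λ z → suc (z + b)) (+-comm b a)) 1+a+b+c≡q)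
      ... | no c≢a | no c≢b = <-irrefl refl (begin-strict
        q + 1                           <⟨ +-monoˡ-< 1 (m<m+n q (≤-trans (s≤s z≤n) 2k<q)) ⟩
        q + q + 1                       ≡⟨ cong (λ z → z + z + 1) (sym 1+a+b+c≡q) ⟩
        suc (a + b + c) + suc (a + b + c) + 1 ≡⟨ regroup a b c ⟩
        a + b + c + (a + b + c) + 3     ≤⟨ EtaArm-triple a∈ b∈ c∈ a≢b (≢-sym c≢a) (≢-sym c≢b) ⟩
        k + k + 2                       ≡⟨ +2≡ k ⟩
        suc (k + k) + 1                 ≤⟨ +-monoˡ-≤ 1 2k<q ⟩
        q + 1                           ∎)
        where
        regroup : ∀ a b c → suc (a + b + c) + suc (a + b + c) + 1 ≡ a + b + c + (a + b + c) + 3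
        regroup = solve-∀
        +2≡ : ∀ k → k + k + 2 ≡ suc (k + k) + 1
        +2≡ = solve-∀
      by-cases : x + y ≡ suc (q + q) ⊎ (∃ λ c → EtaArm c × x + y ≡ suc (q + c)) ⊎ x + y ≤ q → ⊥
      by-cases (inj₁ x+y≡top) = <-irrefl refl (begin-strict
        q + q                   <⟨ n<1+n (q + q) ⟩
        suc (q + q)             ≤⟨ m≤m+n (suc (q + q)) (a + b) ⟩
        suc (q + q) + (a + b)   ≡⟨ cong (_+ (a + b)) (sym x+y≡top) ⟩
        x + y + (a + b)         ≡⟨ sum≡2q ⟩
        q + q                   ∎)
      by-cases (inj₂ (inj₂ x+y≤q)) = <-irrefl refl (<-≤-trans k<q (+-cancelˡ-≤ q q k (begin
        q + q                   ≡⟨ sym sum≡2q ⟩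
        x + y + (a + b)         ≤⟨ +-mono-≤ x+y≤q a+b≤k ⟩
        q + k                   ∎)))
      by-cases (inj₂ (inj₁ (c , c∈ , x+y≡))) = three-arms c∈ (+-cancelˡ-≡ q _ _ (begin-equality
        q + suc (a + b + c)     ≡⟨ regroup q a b c ⟩
        suc (q + c) + (a + b)   ≡⟨ cong (_+ (a + b)) (sym x+y≡) ⟩
        x + y + (a + b)         ≡⟨ sum≡2q ⟩
        q + q                   ∎))
        where
        regroup : ∀ q a b c → q + suc (a + b + c) ≡ suc (q + c) + (a + b)
        regroup = solve-∀

    small+large : ∀ {x y a} → x + a ≡ q → EtaArm a → q < y → (∀ {c} → EtaArm c → y ≢ suc (q + c)) → x + y ∉ hookPartition Y
    small+large {x} {y} {a} x+a≡q a∈ q<y not-large x+y∈ = by-cases (part-cases x+y∈)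
      where
      open ≤-Reasoning
      by-cases : x + y ≡ suc (q + q) ⊎ (∃ λ c → EtaArm c × x + y ≡ suc (q + c)) ⊎ x + y ≤ q → ⊥
      by-cases (inj₁ x+y≡top) = not-large a∈ (+-cancelˡ-≡ x y (suc (q + a)) (begin-equality
        x + y                 ≡⟨ x+y≡top ⟩
        suc (q + q)           ≡⟨ cong (λ z → suc (q + z)) (sym x+a≡q) ⟩
        suc (q + (x + a))     ≡⟨ regroup q x a ⟩
        x + suc (q + a)       ∎))
        where
        regroup : ∀ q x a → suc (q + (x + a)) ≡ x + suc (q + a)
        regroup = solve-∀
      by-cases (inj₂ (inj₂ x+y≤q)) = <-irrefl refl (<-≤-trans q<y (≤-trans (m≤n+m y x) x+y≤q))
      by-cases (inj₂ (inj₁ (c , c∈ , x+y≡))) = <-irrefl refl (<-≤-trans 2k<q (begin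
        q           ≡⟨ sym x+a≡q ⟩
        x + a       ≤⟨ +-monoˡ-≤ a x≤c ⟩
        c + a       ≤⟨ arms-≤ (c ≟ a) ⟩
        k + k       ∎))
        where
        x≤c : x ≤ c
        x≤c = +-cancelʳ-≤ (suc q) x c (begin
          x + suc q     ≤⟨ +-monoʳ-≤ x q<y ⟩
          x + y         ≡⟨ x+y≡ ⟩
          suc (q + c)   ≡⟨ +-comm (suc q) c ⟩
          c + suc q     ∎)
        arms-≤ : Dec (c ≡ a) → c + a ≤ k + k
        arms-≤ (yes refl) = +-mono-≤ (EtaArm-≤ {a} a∈) (EtaArm-≤ {a} a∈)
        arms-≤ (no c≢a) = ≤-trans (EtaArm-pair c∈ a∈ c≢a) (m≤n+m k k)

    large+large : ∀ {x y} → q < x → q < y → x + y ∉ hookPartition Y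
    large+large {x} {y} q<x q<y x+y∈ = <-irrefl refl (begin-strict
      suc (q + q)         <⟨ n<1+n (suc (q + q)) ⟩
      suc (suc (q + q))   ≡⟨ cong suc (+-suc q q) ⟨
      suc q + suc q       ≤⟨ +-mono-≤ q<x q<y ⟩
      x + y               ≤⟨ part-≤ x+y∈ ⟩
      suc (q + q)         ∎)
      where open ≤-Reasoning

  unrefinable : Unrefinable (hookPartition Y)
  unrefinable (x , y , x≢y , (1≤x , _ , x∉) , (1≤y , _ , y∉) , x+y∈) with x ≤? q | y ≤? q
  ... | yes x≤q | yes y≤q =
    small-missing 1≤x x≤q x∉ λ (a , a∈ , x+a≡q) →
    small-missing 1≤y y≤q y∉ λ (b , b∈ , y+b≡q) → small+small x+a≡q a∈ y+b≡q b∈ x≢y x+y∈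
  ... | yes x≤q | no y≰q =
    small-missing 1≤x x≤q x∉ λ (a , a∈ , x+a≡q) → small+large x+a≡q a∈ (≰⇒> y≰q) (large-missing y∉) x+y∈
  ... | no x≰q | yes y≤q =
    small-missing 1≤y y≤q y∉ λ (b , b∈ , y+b≡q) →
    small+large y+b≡q b∈ (≰⇒> x≰q) (large-missing x∉) (subst (_∈ hookPartition Y) (+-comm x y) x+y∈)
  ... | no x≰q | no y≰q = large+large (≰⇒> x≰q) (≰⇒> y≰q) x+y∈

  eta-odd : ∀ {η} → η ∈ eta → ∃ λ b → EtaArm b × η ≡ b + b + 1
  eta-odd η∈ with ∈eta⇒lower-arm η∈
  ... | j , 2≤j , j≤r , refl = a j , lower-arm-∈ 2≤j j≤r , refl

  largest-hooks : largest (hookPartition Y) ≡ suc (q + q)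
  largest-hooks = trans largest-hookPartition (cong (λ z → suc (z + z)) a₁≡q)

  private
    -- The missing part x ≤ q with x + b ≡ q is matched with the part 2b + 1 of η.
    index : ℕ → ℕ
    index η = q ∸ η / 2

    weight-of : ℕ → ℕ
    weight-of x = suc (q + q) ∸ (x + x)

    b<q : ∀ b → EtaArm b → b < q
    b<q b b∈ = ≤-<-trans (EtaArm-≤ {b} b∈) k<q

    index-odd : ∀ b → index (b + b + 1) ≡ q ∸ b
    index-odd b = trans (cong (λ z → q ∸ z / 2) (+-comm (b + b) 1)) (cong (q ∸_) (half-odd b))

    index-range : ∀ {η} → η ∈ eta → 1 ≤ index η × index η < 1 + q
    index-range η∈ with eta-odd η∈
    ... | b , b∈ , refl = ≤-trans (m<n⇒0<n∸m (b<q b b∈)) (≤-reflexive (sym (index-odd b))) ,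
                          s≤s (≤-trans (≤-reflexive (index-odd b)) (m∸n≤m q b))

    weight-index : ∀ {η} → η ∈ eta → weight-of (index η) ≡ η
    weight-index η∈ with eta-odd η∈
    ... | b , b∈ , refl = begin
      weight-of (index (b + b + 1))       ≡⟨ cong weight-of (index-odd b) ⟩
      suc (q + q) ∸ (u + u)               ≡⟨ cong (λ z → suc (z + z) ∸ (u + u)) q≡u+b ⟩
      suc (u + b + (u + b)) ∸ (u + u)     ≡⟨ cong (_∸ (u + u)) (regroup u b) ⟩
      u + u + (b + b + 1) ∸ (u + u)       ≡⟨ m+n∸m≡n (u + u) _ ⟩
      b + b + 1                           ∎
      where
      open ≡-Reasoning
      u = q ∸ b
      q≡u+b : q ≡ u + b
      q≡u+b = sym (m∸n+n≡m (<⇒≤ (b<q b b∈)))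
      regroup : ∀ u b → suc (u + b + (u + b)) ≡ u + u + (b + b + 1)
      regroup = solve-∀

    index-injective : ∀ {η η'} → η ∈ eta → η' ∈ eta → index η ≡ index η' → η ≡ η'
    index-injective η∈ η'∈ index≡ with eta-odd η∈ | eta-odd η'∈
    ... | b , b∈ , refl | c , c∈ , refl =
      cong (λ z → z + z + 1) (∸-cancelˡ-≡ (<⇒≤ (b<q b b∈)) (<⇒≤ (b<q c c∈)) (trans (sym (index-odd b)) (trans index≡ (index-odd c))))

    missing⇔ : ∀ x → 1 ≤ x → x < 1 + q → x ∉ hookPartition Y ⇔ Any (λ η → x ≡ index η) eta
    missing⇔ x 1≤x (s≤s x≤q) = mk⇔ into back
      where
      into : x ∉ hookPartition Y → Any (λ η → x ≡ index η) eta
      into x∉ = decidable-stable (any? (λ η → x ≟ index η) eta) λ none →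
        small-missing 1≤x x≤q x∉ λ (b , b∈ , x+b≡q) →
          none (lose b∈ (trans (sym (m+n∸n≡m x b)) (trans (cong (_∸ b) x+b≡q) (sym (index-odd b)))))
      back : Any (λ η → x ≡ index η) eta → x ∉ hookPartition Y
      back x≡index x∈ with find x≡index
      ... | η , η∈ , x≡ with eta-odd η∈ | ∈hookPartition⇒ x∈
      ...   | _ , _ , _ | inj₁ (_ , _ , x≡1+a₁+b) =
        <-irrefl refl (≤-trans (s≤s (≤-trans (≤-reflexive (sym a₁≡q)) (m≤m+n (a 1) _))) (≤-trans (≤-reflexive (sym x≡1+a₁+b)) x≤q))
      ...   | b , b∈ , refl | inj₂ (_ , _ , no-gap) =
        no-gap (b , EtaArm⇒DiagonalArm b∈ , trans (trans (cong (_+ b) (trans x≡ (index-odd b))) (m∸n+n≡m (<⇒≤ (b<q b b∈)))) (sym a₁≡q))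

  sum-hooks : sum (hookPartition Y) ≡ tri q + (suc k + suc k) + suc (q + q)
  sum-hooks = begin
    sum (hookPartition Y)
      ≡⟨ sum-hookPartition ⟩
    tri (a 1) + ∑ (λ x → [ ¬? (x ∈? hookPartition Y) ]· (suc (a 1 + a 1) ∸ (x + x))) 1 (a 1) + suc (a 1 + a 1)
      ≡⟨ cong (λ z → tri z + ∑ (λ x → [ ¬? (x ∈? hookPartition Y) ]· (suc (z + z) ∸ (x + x))) 1 z + suc (z + z)) a₁≡q ⟩
    tri q + ∑ (λ x → [ ¬? (x ∈? hookPartition Y) ]· weight-of x) 1 q + suc (q + q)
      ≡⟨ cong (λ s → tri q + s + suc (q + q)) missing≡eta ⟩
    tri q + sum eta + suc (q + q)
      ≡⟨ cong (λ s → tri q + s + suc (q + q)) (trans sum-eta′ (regroup k)) ⟩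
    tri q + (suc k + suc k) + suc (q + q) ∎
    where
    open ≡-Reasoning
    missing≡eta : ∑ (λ x → [ ¬? (x ∈? hookPartition Y) ]· weight-of x) 1 q ≡ sum eta
    missing≡eta = trans (∑-[]·-image weight-of index (λ x → ¬? (x ∈? hookPartition Y)) eta 1 q missing⇔
                           (injective-on⇒distinct-image index index-injective (Linked<⇒distinct eta-increasing))
                           (tabulate index-range))
                        (cong sum (map-id-local (tabulate weight-index)))
    regroup : ∀ k → k + k + 2 ≡ suc k + suc k
    regroup = solve-∀

  hooks∈Ubar : InUbar (tri q + (suc k + suc k) + suc (q + q)) (hookPartition Y)
  hooks∈Ubar = ((hookPartition-increasing Y young , tabulate (proj₁ ∘ hookPartition-range) , 2≤length , sum-hooks) ,
                unrefinable , maximal) ,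
               length-missing-hookPartition
    where
    2≤length : 2 ≤ length (hookPartition Y)
    2≤length = ≤-trans (s≤s (≤-trans (s≤s z≤n) (≤-trans 2k<q (≤-reflexive (sym a₁≡q))))) (≤-reflexive (sym length-hookPartition))
    maximal : ∀ mu → IsDistinctPartition (tri q + (suc k + suc k) + suc (q + q)) mu → Unrefinable mu →
              largest mu ≤ largest (hookPartition Y)
    maximal mu partition unrefinable-mu =
      ≤-trans (unrefinable-largest-≤ q (suc k) mu (s≤s (≤-trans (≤-reflexive (+-suc k k)) 2k<q)) partition unrefinable-mu)
              (≤-reflexive (sym largest-hooks))

module InTermsOfQ (n k : ℕ) (2k+4≤n : 2 * k + 4 ≤ n) where

  q : ℕ
  q = n ∸ 3

  n≡3+q : n ≡ 3 + q
  n≡3+q = sym (m+[n∸m]≡n (≤-trans (≤-trans (n≤1+n 3) (m≤n+m 4 (2 * k))) 2k+4≤n))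

  2k<q : k + k < q
  2k<q = +-cancelˡ-≤ 3 _ _ (≤-trans (≤-reflexive (shape k)) (≤-trans 2k+4≤n (≤-reflexive n≡3+q)))
    where
    shape : ∀ k → 3 + suc (k + k) ≡ 2 * k + 4
    shape = solve-∀

  2n∸5≡ : 2 * n ∸ 5 ≡ suc (q + q)
  2n∸5≡ = trans (cong (λ m → 2 * m ∸ 5) n≡3+q) (trans (cong (_∸ 5) (shape q)) (m+n∸m≡n 5 _))
    where
    shape : ∀ q → 2 * (3 + q) ≡ 5 + suc (q + q)
    shape = solve-∀

  exceptional-case : q ≡ k + k + 1 → 2 * k + 4 ≡ n
  exceptional-case q≡ = trans (shape k) (trans (cong (3 +_) (sym q≡)) (sym n≡3+q))
    where
    shape : ∀ k → 2 * k + 4 ≡ 3 + (k + k + 1)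
    shape = solve-∀

  T∸≡ : T n ∸ (n ∸ 2 * k) ≡ tri q + (suc k + suc k) + suc (q + q)
  T∸≡ = begin
    T n ∸ d                                             ≡⟨ cong (_∸ d) (T≡tri n) ⟩
    tri n ∸ d                                           ≡⟨ cong (λ m → tri m ∸ d) n≡3+q ⟩
    tri (3 + q) ∸ d                                     ≡⟨ cong (_∸ d) tri[3+q]≡ ⟩
    (3 + q) + ((2 + q) + ((1 + q) + tri q)) ∸ d         ≡⟨ cong (λ z → z + ((2 + q) + ((1 + q) + tri q)) ∸ d) (trans (m∸n+n≡m 2k≤n) n≡3+q) ⟨
    d + 2 * k + ((2 + q) + ((1 + q) + tri q)) ∸ d       ≡⟨ cong (_∸ d) (regroup d k q (tri q)) ⟩
    tri q + (suc k + suc k) + suc (q + q) + d ∸ d       ≡⟨ m+n∸n≡m _ d ⟩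
    tri q + (suc k + suc k) + suc (q + q)               ∎
    where
    open ≡-Reasoning
    d = n ∸ 2 * k
    2k≤n : 2 * k ≤ n
    2k≤n = ≤-trans (m≤m+n (2 * k) 4) 2k+4≤n
    tri[3+q]≡ : tri (3 + q) ≡ (3 + q) + ((2 + q) + ((1 + q) + tri q))
    tri[3+q]≡ = trans (tri-suc (2 + q)) (cong ((3 + q) +_) (trans (tri-suc (1 + q)) (cong ((2 + q) +_) (tri-suc q))))
    regroup : ∀ d k q t → d + 2 * k + ((2 + q) + ((1 + q) + t)) ≡ t + (suc k + suc k) + suc (q + q) + d
    regroup = solve-∀

theorem4p15 : (n k : ℕ) → 2 ≤ 2 * k → 2 * k + 4 ≤ n →
    (eta : List ℕ) → InDoBar n k eta →
    (Y : List ℕ) → IsYoungDiagram Y →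
    InY Y (length eta + 1) (length eta + 1) →
    ¬ InY Y (length eta + 2) (length eta + 2) →
    hook Y 1 1 ≡ 2 * n ∸ 5 →
    ((i : ℕ) → 2 ≤ i → i ≤ length eta + 1 →
       hook Y i i ≡ nth eta (length eta ∸ (i ∸ 2))) →
    ((i : ℕ) → 1 ≤ i → i ≤ length eta + 1 → arm Y i i ≡ leg Y i i) →
    Unrefinable (hookPartition Y) ×
    InUbar (T n ∸ (n ∸ 2 * k)) (hookPartition Y)
theorem4p15 n k 2≤2k 2k+4≤n eta (((eta-increasing , eta-positive , _ , sum-eta) , _) , exceptional)
            Y young durfee beyond-durfee corner-hook diagonal-hooks balanced =
  unrefinable , subst (λ N → InUbar N (hookPartition Y)) (sym T∸≡) hooks∈Ubar
  where
  open InTermsOfQ n k 2k+4≤n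
  open DiagramOfEta q k (*-cancelˡ-≤ 2 2≤2k) 2k<q eta eta-increasing eta-positive sum-eta (exceptional ∘ exceptional-case)
                    Y young durfee beyond-durfee (trans corner-hook 2n∸5≡) diagonal-hooks balanced
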